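{- Let $G$ be a finite graph on vertex set $V$ with a fixed linear order $\prec$ on $V$, let $xy\in G$, and let $\gamma\ge0$ be an integer. If $S_\gamma(xy)$ is a triangle-tree, then $S^*_\gamma(xy)=S_\gamma(xy)$.
   Context: A triangle-tree is a graph obtainable by starting with an edge (the root) and repeatedly adding a triangle consisting of an already present edge and a new vertex. A triangle-path is a triangle-tree in which each new triangle uses an edge added in the preceding step (the first uses the root); its length is its number of triangles. For a graph $H$ and edges $e,f$ of $H$, $\mathrm{dist}_H(e,f)$ is the minimum length of a triangle-path in $H$ with root $e$ containing $f$. $S(xy)$ is the triangle-component of $G$ containing $xy$ (the maximal subgraph containing $xy$ any two of whose edges are joined by a triangle-path inside it), and $S_\gamma(xy)=\{e\in S(xy):\mathrm{dist}_G(xy,e)\le\gamma\}$. The breadth-first triangle-tree $S^*(xy)\subseteq G$ is built as follows. Start with the triangles $xyz$, $z\in N(x)\cap N(y)$; each such $z$ is put in a queue with base $xy$, and $x,y$ are marked processed. Repeatedly take the queued vertex $v$ that entered the tree earliest (ties broken by $\prec$), with base $ab$ (where $abv$ is the triangle through which $v$ entered), and process it: add all triangles $avw$ with $w\in N(a)\cap N(v)$ and $bvw$ with $w\in N(b)\cap N(v)$, for $w$ a vertex not yet in the tree; each such $w$ enters the queue with base $av$ or $bv$ respectively; then $v$ is removed from the queue and marked processed. Stop when the queue is empty; $S^*(xy)$ is the union of all triangles added (a triangle-tree rooted at $xy$). $S^*_\gamma(xy)=\{e\in S^*(xy):\mathrm{dist}_{S^*(xy)}(xy,e)\le\gamma\}$.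 -}

module Defs where

open import Data.Nat using (ℕ; zero; suc; _≤_; _<_)
open import Data.Fin using (Fin; _≟_)
open import Data.Fin.Permutation using (Permutation′; _⟨$⟩ʳ_; _⟨$⟩ˡ_)
open import Data.Bool using (Bool; true; false; _∧_; if_then_else_; not)
open import Data.List using (List; []; _∷_; _++_; map; filter; foldl)
open import Data.Bool.ListAction using (any)
open import Data.List.Membership.Propositional using (_∈_; _∉_)
open import Data.Product using (_×_; _,_; ∃; Σ; proj₁)
open import Data.Sum using (_⊎_)
open import Data.Fin.Base using (toℕ)
open import Data.Vec.Functional using ()
open import Relation.Binary.PropositionalEquality using (_≡_; _≢_)
open import Relation.Nullary using (does)
open import Function.Bundles using (_⇔_)
import Data.List as L

record Graph (n : ℕ) : Set where
  field
    adj    : Fin n → Fin n → Bool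
    sym    : ∀ u v → adj u v ≡ adj v u
    irrefl : ∀ v → adj v v ≡ false
open Graph public

Edge : ∀ {n} → Graph n → Fin n → Fin n → Set
Edge G u v = adj G u v ≡ true

EdgeRel : ℕ → Set₁
EdgeRel n = Fin n → Fin n → Set

-- The linear order ≺ on V is given by a permutation π ("rank"):
-- u ≺ v  iff  π u < π v.

_≺[_]_ : ∀ {n} → Fin n → Permutation′ n → Fin n → Set
u ≺[ π ] v = toℕ (π ⟨$⟩ʳ u) < toℕ (π ⟨$⟩ʳ v)

-- All vertices listed in ≺-increasing order.
ordered : ∀ {n} → Permutation′ n → List (Fin n)
ordered {n} π = map (π ⟨$⟩ˡ_) (L.allFin n)

-- Unordered pairs stored in lists

_∈ₑ_ : ∀ {n} → (Fin n × Fin n) → List (Fin n × Fin n) → Set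
(u , v) ∈ₑ es = ((u , v) ∈ es) ⊎ ((v , u) ∈ es)

data TT {n : ℕ} : List (Fin n) → List (Fin n × Fin n) → Set where
  root : (a b : Fin n) → a ≢ b → TT (a ∷ b ∷ []) ((a , b) ∷ [])
  add  : ∀ {vs es} → TT vs es → (a b w : Fin n) → (a , b) ∈ₑ es → w ∉ vs →
         TT (w ∷ vs) ((a , w) ∷ (b , w) ∷ es)

IsTriangleTree : ∀ {n} → EdgeRel n → Set
IsTriangleTree {n} F =
  ∃ λ (vs : List (Fin n)) → ∃ λ (es : List (Fin n × Fin n)) →
    TT vs es × (∀ u v → F u v ⇔ (u , v) ∈ₑ es)

-- TPath H vis c d : the remainder of a triangle-path whose vertex set so
-- far is vis, where cd is the edge the next triangle must use (the root
-- for the first triangle; afterwards one of the two edges added in the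
-- preceding step).

data TPath {n : ℕ} (H : EdgeRel n) : List (Fin n) → Fin n → Fin n → Set where
  stop : ∀ {vis c d} → TPath H vis c d
  step : ∀ {vis c d} (w : Fin n) → w ∉ vis → H c w → H d w →
         (next : Bool) → TPath H (w ∷ vis) (if next then c else d) w →
         TPath H vis c d

len : ∀ {n} {H : EdgeRel n} {vis c d} → TPath H vis c d → ℕ
len stop = 0
len (step _ _ _ _ _ p) = suc (len p)

data Added {n : ℕ} {H : EdgeRel n} : ∀ {vis c d} → TPath H vis c d → Fin n → Fin n → Set where
  new-c : ∀ {vis c d w w∉ hc hd nx p} → Added {vis = vis} {c} {d} (step w w∉ hc hd nx p) c w
  new-d : ∀ {vis c d w w∉ hc hd nx p} → Added {vis = vis} {c} {d} (step w w∉ hc hd nx p) d w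
  later : ∀ {vis c d w w∉ hc hd nx p u v} → Added p u v →
          Added {vis = vis} {c} {d} (step w w∉ hc hd nx p) u v

record PathWithin {n : ℕ} (H : EdgeRel n) (a b u v : Fin n) (γ : ℕ) : Set where
  field
    rootIn   : H a b
    path     : TPath H (a ∷ b ∷ []) a b
    short    : len path ≤ γ
    contains : ((u ≡ a × v ≡ b) ⊎ (u ≡ b × v ≡ a)) ⊎
               (Added path u v ⊎ Added path v u)

-- dist_H(ab, uv) ≤ γ  (dist is the minimum length of a triangle-path in H
-- with root ab containing uv; the minimum is ≤ γ iff some such path has
-- length ≤ γ).
DistLe : ∀ {n} → EdgeRel n → Fin n → Fin n → Fin n → Fin n → ℕ → Set
DistLe H a b u v γ = PathWithin H a b u v γ

-- uv ∈ S(xy): the triangle-component of G containing xy, i.e. uv is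
-- joined to xy by a triangle-path in G (rooted at xy).
InS : ∀ {n} → Graph n → Fin n → Fin n → EdgeRel n
InS G x y u v = ∃ λ (k : ℕ) → PathWithin (Edge G) x y u v k

Sγ : ∀ {n} → Graph n → Fin n → Fin n → ℕ → EdgeRel n
Sγ G x y γ u v = InS G x y u v × DistLe (Edge G) x y u v γ

mem : ∀ {n} → Fin n → List (Fin n) → Bool
mem w vs = any (λ u → does (u ≟ w)) vs

record State (n : ℕ) : Set where
  constructor st
  field
    inTree : List (Fin n)
    queue  : List (Fin n × Fin n × Fin n)    -- (v , base a b), FIFO
    edges  : List (Fin n × Fin n)

-- Processing v with base ab: go through candidates w in ≺-order (so the
-- vertices entering in this step are queued in ≺-order); a vertex w not
-- yet in the tree with w ∈ N(a) ∩ N(v) gets triangle avw (base av);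
-- otherwise, if w ∈ N(b) ∩ N(v), triangle bvw (base bv).
processW : ∀ {n} → Graph n → Fin n → Fin n → Fin n → State n → Fin n → State n
processW G v a b (st T Q E) w =
  if mem w T then st T Q E
  else if adj G a w ∧ adj G v w
       then st (w ∷ T) (Q ++ ((w , a , v) ∷ [])) ((a , w) ∷ (v , w) ∷ E)
       else if adj G b w ∧ adj G v w
            then st (w ∷ T) (Q ++ ((w , b , v) ∷ [])) ((b , w) ∷ (v , w) ∷ E)
            else st T Q E

initial : ∀ {n} → Graph n → Permutation′ n → Fin n → Fin n → State n
initial G π x y =
  foldl (λ s z → if adj G x z ∧ adj G y z
                 then st (z ∷ State.inTree s) (State.queue s ++ ((z , x , y) ∷ []))
                         ((x , z) ∷ (y , z) ∷ State.edges s)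
                 else s)
        (st (x ∷ y ∷ []) [] ((x , y) ∷ []))
        (ordered π)

-- main loop; each vertex is queued at most once, so n rounds suffice
run : ∀ {n} → Graph n → Permutation′ n → ℕ → State n → State n
run G π zero s = s
run G π (suc k) (st T [] E) = st T [] E
run G π (suc k) (st T ((v , a , b) ∷ Q) E) =
  run G π k (foldl (processW G v a b) (st T Q E) (ordered π))

S*edges : ∀ {n} → Graph n → Permutation′ n → Fin n → Fin n → List (Fin n × Fin n)
S*edges {n} G π x y = State.edges (run G π n (initial G π x y))

S* : ∀ {n} → Graph n → Permutation′ n → Fin n → Fin n → EdgeRel n
S* G π x y u v = (u , v) ∈ₑ S*edges G π x y

S*γ : ∀ {n} → Graph n → Permutation′ n → Fin n → Fin n → ℕ → EdgeRel n
S*γ G π x y γ u v = S* G π x y u v × DistLe (S* G π x y) x y u v γ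

-- As S* ⊆ G, triangle-paths in S* are triangle-paths in G, so S*_γ ⊆ S_γ.
-- Conversely it suffices that every edge of a triangle-path P in G rooted at
-- xy of length ≤ γ lies in S*, for then P is a triangle-path in S*.  We follow
-- P triangle by triangle: when the algorithm processes the vertex d that
-- entered through the previous triangle, with a base ab ∋ c, the next
-- triangle cdw of P is added with base cd.  Indeed w is not yet in the tree,
-- as otherwise dw would be an edge of the triangle-tree S_γ between two tree
-- vertices, hence a tree edge (triangle-subtrees are induced subgraphs, by
-- the 2k − 3 edge bound), and the base chosen is cd, as otherwise a, b, d, w
-- would span a K₄ in S_γ.  This rests on an invariant of the breadth-first
-- loop (queue in level order, partial tree within distance h + 2 of xy), on
-- fairness (each queued vertex is processed) and on termination in n rounds.

module Submission where

open import Defs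
open import Data.Nat using (ℕ; zero; suc; _+_; _≤_; _<_; z≤n; s≤s)
open import Data.Nat.Properties using (module ≤-Reasoning; ≤-refl; ≤-trans; ≤-reflexive; <-irrefl; m≤n⇒m≤1+n; n≤1+n; m≤n+m; m≤m+n; +-mono-≤; +-monoˡ-≤; +-cancelʳ-≤; +-comm; +-assoc; +-suc; +-identityʳ)
open import Data.Nat.Tactic.RingSolver using (solve-∀)
open import Data.Fin using (Fin; _≟_)
open import Data.Fin.Permutation using (Permutation′; _⟨$⟩ʳ_; _⟨$⟩ˡ_; inverseˡ; inverseʳ)
open import Data.Bool using (Bool; true; false; _∧_; if_then_else_)
open import Data.Bool.Properties using (∧-zeroʳ; ∧-identityʳ; ∧-conicalˡ; ∧-conicalʳ)
open import Data.List using (List; []; _∷_; _++_; length; foldl)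
import Data.List as L
open import Data.List.Properties using (++-assoc; ++-identityʳ; length-++; length-tabulate)
open import Data.List.Membership.Propositional using (_∈_; _∉_)
open import Data.List.Membership.Propositional.Properties using (∈-∃++; ∈-++⁻; ∈-++⁺ˡ; ∈-++⁺ʳ; ∈-map⁺; ∈-allFin)
open import Data.List.Relation.Unary.Any using (here; there)
open import Data.List.Relation.Unary.All using ([]; _∷_)
import Data.List.Relation.Unary.All as All
open import Data.List.Relation.Unary.AllPairs using (AllPairs; []; _∷_)
import Data.List.Relation.Unary.AllPairs.Properties as AllPairs
open import Data.List.Relation.Unary.Unique.Propositional using (Unique)
import Data.List.Relation.Unary.Unique.Propositional.Properties as Unique
open import Data.Product using (_×_; _,_; proj₁; proj₂; ∃; ∃₂; Σ; swap)
open import Data.Product.Properties using (≡-dec)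
open import Data.Sum using (_⊎_; inj₁; inj₂; [_,_]′)
import Data.Sum
open import Data.Empty using (⊥; ⊥-elim)
open import Relation.Nullary using (¬_; yes; no)
open import Function.Bundles using (_⇔_; mk⇔; Equivalence)
open import Relation.Binary.PropositionalEquality renaming (sym to ≡-sym)

module _ {n : ℕ} where
  mem-sound : ∀ {w : Fin n} vs → mem w vs ≡ true → w ∈ vs
  mem-sound {w} (u ∷ vs) e with u ≟ w
  ... | yes refl = here refl
  ... | no _ = there (mem-sound vs e)

  mem-complete : ∀ {w : Fin n} {vs} → w ∈ vs → mem w vs ≡ true
  mem-complete {w} {u ∷ vs} (here refl) with u ≟ u
  ... | yes _ = refl
  ... | no u≢u = ⊥-elim (u≢u refl)
  mem-complete {w} {u ∷ vs} (there p) with u ≟ w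
  ... | yes _ = refl
  ... | no _ = mem-complete p

  mem-false : ∀ {w : Fin n} vs → mem w vs ≡ false → w ∉ vs
  mem-false vs e p with trans (≡-sym (mem-complete p)) e
  ... | ()

  mem-∉ : ∀ {w : Fin n} {vs} → w ∉ vs → mem w vs ≡ false
  mem-∉ {w} {vs} w∉ with mem w vs in e
  ... | true = ⊥-elim (w∉ (mem-sound vs e))
  ... | false = refl

length-snoc : ∀ {A : Set} (Q : List A) z {t q T} → length Q + t ≡ q + T → length (Q ++ z ∷ []) + t ≡ q + suc T
length-snoc Q z {t} {q} {T} balance = begin
  length (Q ++ z ∷ []) + t  ≡⟨ cong (_+ t) (length-++ Q) ⟩
  (length Q + 1) + t        ≡⟨ +-assoc (length Q) 1 t ⟩
  length Q + suc t          ≡⟨ +-suc (length Q) t ⟩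
  suc (length Q + t)        ≡⟨ cong suc balance ⟩
  suc (q + T)               ≡⟨ ≡-sym (+-suc q T) ⟩
  q + suc T                 ∎
  where open ≡-Reasoning

≢-either : ∀ {A : Set} {r a b c : A} → r ≢ a → r ≢ b → c ≡ a ⊎ c ≡ b → r ≢ c
≢-either r≢a _ (inj₁ refl) = r≢a
≢-either _ r≢b (inj₂ refl) = r≢b

Distinct : ∀ {A : Set} → (A → A → Set) → List A → Set
Distinct R = AllPairs (λ a b → ¬ R a b)

distinct-length : ∀ {A : Set} (R : A → A → Set) →
                  (∀ {a b} → R a b → R b a) → (∀ {a b c} → R a b → R b c → R a c) →
                  ∀ L M → Distinct R L → (∀ {z} → z ∈ L → ∃ λ m → m ∈ M × R z m) →
                  length L ≤ length M
distinct-length R R-sym R-trans [] M _ _ = z≤n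
distinct-length R R-sym R-trans (l ∷ L) M (l≉L ∷ dL) cover with cover (here refl)
... | m , m∈M , Rlm with ∈-∃++ m∈M
... | M₁ , M₂ , refl =
  ≤-trans (s≤s (distinct-length R R-sym R-trans L (M₁ ++ M₂) dL cover′))
          (≤-reflexive (≡-sym (length-middle M₁)))
  where
  length-middle : ∀ M₁ → length (M₁ ++ m ∷ M₂) ≡ suc (length (M₁ ++ M₂))
  length-middle [] = refl
  length-middle (_ ∷ M₁) = cong suc (length-middle M₁)

  -- m is used up by l, so the rest of L is covered by the rest of M
  cover′ : ∀ {z} → z ∈ L → ∃ λ m′ → m′ ∈ M₁ ++ M₂ × R z m′
  cover′ z∈L with cover (there z∈L)
  ... | m′ , m′∈ , Rzm′ with ∈-++⁻ M₁ m′∈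
  ... | inj₁ p = m′ , ∈-++⁺ˡ p , Rzm′
  ... | inj₂ (here refl) = ⊥-elim (All.lookup l≉L z∈L (R-trans Rlm (R-sym Rzm′)))
  ... | inj₂ (there p) = m′ , ∈-++⁺ʳ M₁ p , Rzm′

module _ {n : ℕ} where
  SameEdge : (Fin n × Fin n) → (Fin n × Fin n) → Set
  SameEdge p q = p ≡ q ⊎ p ≡ swap q

  SameEdge-sym : ∀ {p q} → SameEdge p q → SameEdge q p
  SameEdge-sym (inj₁ refl) = inj₁ refl
  SameEdge-sym (inj₂ refl) = inj₂ refl

  SameEdge-trans : ∀ {p q r} → SameEdge p q → SameEdge q r → SameEdge p r
  SameEdge-trans (inj₁ refl) s = s
  SameEdge-trans (inj₂ refl) (inj₁ refl) = inj₂ refl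
  SameEdge-trans (inj₂ refl) (inj₂ refl) = inj₁ refl

  flipₑ : ∀ {u v : Fin n} {es} → (u , v) ∈ₑ es → (v , u) ∈ₑ es
  flipₑ (inj₁ p) = inj₂ p
  flipₑ (inj₂ p) = inj₁ p

  ∈ₑ-mono : ∀ {es es′ : List (Fin n × Fin n)} → (∀ {e} → e ∈ es → e ∈ es′) →
            ∀ {u v} → (u , v) ∈ₑ es → (u , v) ∈ₑ es′
  ∈ₑ-mono f (inj₁ p) = inj₁ (f p)
  ∈ₑ-mono f (inj₂ p) = inj₂ (f p)

-- Number of edges of a triangle-tree on k ≥ 2 vertices: 2k − 3.
triEdges : ℕ → ℕ
triEdges 0 = 0
triEdges 1 = 0
triEdges (suc (suc k)) = suc (k + k)

triEdges-suc : ∀ {m} → 2 ≤ m → triEdges (suc m) ≡ 2 + triEdges m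
triEdges-suc {suc (suc k)} (s≤s (s≤s z≤n)) = cong (λ t → suc (suc t)) (+-suc k k)

module _ {n : ℕ} where
  tt-endpoints : ∀ {vs es} → TT {n} vs es → ∀ {u v} → (u , v) ∈ es → u ∈ vs × v ∈ vs
  tt-endpointsₑ : ∀ {vs es} → TT {n} vs es → ∀ {u v} → (u , v) ∈ₑ es → u ∈ vs × v ∈ vs

  tt-endpoints (root a b _) (here refl) = here refl , there (here refl)
  tt-endpoints (add t a b w ab _) (here refl) = there (proj₁ (tt-endpointsₑ t ab)) , here refl
  tt-endpoints (add t a b w ab _) (there (here refl)) = there (proj₂ (tt-endpointsₑ t ab)) , here refl
  tt-endpoints (add t a b w ab _) (there (there p)) =
    there (proj₁ (tt-endpoints t p)) , there (proj₂ (tt-endpoints t p))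

  tt-endpointsₑ t (inj₁ p) = tt-endpoints t p
  tt-endpointsₑ t (inj₂ p) = swap (tt-endpoints t p)

  tt-loopless : ∀ {vs es} → TT {n} vs es → ∀ {u v} → (u , v) ∈ es → u ≢ v
  tt-loopless (root a b a≢b) (here refl) = a≢b
  tt-loopless (add t a b w ab w∉) (here refl) refl = w∉ (proj₁ (tt-endpointsₑ t ab))
  tt-loopless (add t a b w ab w∉) (there (here refl)) refl = w∉ (proj₂ (tt-endpointsₑ t ab))
  tt-loopless (add t a b w ab w∉) (there (there p)) = tt-loopless t p

  tt-looplessₑ : ∀ {vs es} → TT {n} vs es → ∀ {u v} → (u , v) ∈ₑ es → u ≢ v
  tt-looplessₑ t (inj₁ p) = tt-loopless t p
  tt-looplessₑ t (inj₂ p) u≡v = tt-loopless t p (≡-sym u≡v)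

  tt-unique : ∀ {vs es} → TT {n} vs es → Unique vs
  tt-unique (root a b a≢b) = (a≢b ∷ []) ∷ [] ∷ []
  tt-unique (add {vs} t a b w ab w∉) = All.tabulate (λ z∈ w≡z → w∉ (subst (_∈ vs) (≡-sym w≡z) z∈)) ∷ tt-unique t

  tt-size : ∀ {vs es} → TT {n} vs es → 2 ≤ length vs
  tt-size (root a b _) = ≤-refl
  tt-size (add t _ _ _ _ _) = m≤n⇒m≤1+n (tt-size t)

  tt-edge-count : ∀ {vs es} → TT {n} vs es → length es ≡ triEdges (length vs)
  tt-edge-count (root a b _) = refl
  tt-edge-count (add t a b w ab w∉) =
    trans (cong (2 +_) (tt-edge-count t)) (≡-sym (triEdges-suc (tt-size t)))

  tt-edges-distinct : ∀ {vs es} → TT {n} vs es → Distinct SameEdge es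
  tt-edges-distinct (root a b _) = [] ∷ []
  tt-edges-distinct (add {vs} {es} t a b w ab w∉) =
    (new≢ab ∷ All.tabulate (λ z∈ → avoids-w z∈))
    ∷ All.tabulate (λ z∈ → avoids-w z∈) ∷ tt-edges-distinct t
    where
    avoids-w : ∀ {z c} → z ∈ es → ¬ SameEdge (c , w) z
    avoids-w z∈ (inj₁ refl) = w∉ (proj₂ (tt-endpoints t z∈))
    avoids-w z∈ (inj₂ refl) = w∉ (proj₁ (tt-endpoints t z∈))
    new≢ab : ¬ SameEdge (a , w) (b , w)
    new≢ab (inj₁ e) = tt-looplessₑ t ab (cong proj₁ e)
    new≢ab (inj₂ e) = w∉ (subst (_∈ vs) (cong proj₁ e) (proj₁ (tt-endpointsₑ t ab)))

indicator : Bool → ℕ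
indicator true = 1
indicator false = 0

triEdges-pos : ∀ {m} → 2 ≤ m → 1 ≤ triEdges m
triEdges-pos {suc (suc _)} (s≤s (s≤s z≤n)) = s≤s z≤n

triEdges-grow : ∀ m X Y → X ≤ 2 → X ≤ m → Y ≤ triEdges m → X + Y ≤ triEdges (suc m)
triEdges-grow zero .zero .zero _ z≤n z≤n = z≤n
triEdges-grow (suc zero) X .zero _ X≤1 z≤n = subst (_≤ 1) (≡-sym (+-identityʳ X)) X≤1
triEdges-grow m@(suc (suc _)) X Y X≤2 _ Y≤ =
  subst (X + Y ≤_) (≡-sym (triEdges-suc {m} (s≤s (s≤s z≤n)))) (+-mono-≤ X≤2 Y≤)

module _ {n : ℕ} where
  open import Data.List.Membership.DecPropositional (_≟_ {n}) using (_∈?_)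
  open import Data.List.Membership.DecPropositional (≡-dec (_≟_ {n}) (_≟_ {n})) using () renaming (_∈?_ to _∈E?_)

  remove : Fin n → List (Fin n) → List (Fin n)
  remove w [] = []
  remove w (u ∷ us) with u ≟ w
  ... | yes _ = remove w us
  ... | no _ = u ∷ remove w us

  ∈-remove : ∀ {w z} W → z ∈ remove w W → z ∈ W × z ≢ w
  ∈-remove {w} (u ∷ us) p with u ≟ w
  ∈-remove {w} (u ∷ us) p | yes _ = let (q , r) = ∈-remove us p in there q , r
  ∈-remove {w} (u ∷ us) (here refl) | no u≢w = here refl , u≢w
  ∈-remove {w} (u ∷ us) (there p) | no _ = let (q , r) = ∈-remove us p in there q , r

  remove-∉ : ∀ {w} W → w ∉ W → remove w W ≡ W
  remove-∉ [] _ = refl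
  remove-∉ {w} (u ∷ us) w∉ with u ≟ w
  ... | yes refl = ⊥-elim (w∉ (here refl))
  ... | no _ = cong (u ∷_) (remove-∉ us (λ p → w∉ (there p)))

  length-remove : ∀ {w} W → Unique W → w ∈ W → suc (length (remove w W)) ≡ length W
  length-remove {w} (u ∷ us) (u∉us ∷ _) p with u ≟ w
  length-remove {w} (u ∷ us) (u∉us ∷ _) p | yes refl =
    cong suc (cong length (remove-∉ us (λ q → All.lookup u∉us q refl)))
  length-remove {w} (u ∷ us) _ (here refl) | no u≢w = ⊥-elim (u≢w refl)
  length-remove {w} (u ∷ us) (_ ∷ uus) (there p) | no _ = cong suc (length-remove us uus p)

  remove-unique : ∀ {w} W → Unique W → Unique (remove w W)
  remove-unique [] _ = []
  remove-unique {w} (u ∷ us) (u∉us ∷ uus) with u ≟ w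
  ... | yes _ = remove-unique us uus
  ... | no _ = All.tabulate (λ q → All.lookup u∉us (proj₁ (∈-remove us q))) ∷ remove-unique us uus

  mem-remove : ∀ {a w} W → a ≢ w → mem a (remove w W) ≡ mem a W
  mem-remove [] _ = refl
  mem-remove {a} {w} (u ∷ us) a≢w with u ≟ w
  mem-remove {a} {w} (u ∷ us) a≢w | yes refl with u ≟ a
  ... | yes refl = ⊥-elim (a≢w refl)
  ... | no _ = mem-remove us a≢w
  mem-remove {a} {w} (u ∷ us) a≢w | no _ with u ≟ a
  ... | yes refl = refl
  ... | no _ = mem-remove us a≢w

  indicator-mem-≤ : ∀ (z : Fin n) W → indicator (mem z W) ≤ length W
  indicator-mem-≤ z [] = z≤n
  indicator-mem-≤ z (u ∷ W) with u ≟ z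
  ... | yes _ = s≤s z≤n
  ... | no _ = m≤n⇒m≤1+n (indicator-mem-≤ z W)

  indicator-pair-≤ : ∀ {a b : Fin n} W → a ≢ b → indicator (mem a W) + indicator (mem b W) ≤ length W
  indicator-pair-≤ [] _ = z≤n
  indicator-pair-≤ {a} {b} (u ∷ W) a≢b with u ≟ a | u ≟ b
  ... | yes refl | yes refl = ⊥-elim (a≢b refl)
  ... | yes refl | no _ = s≤s (indicator-mem-≤ b W)
  ... | no _ | yes refl =
    subst (_≤ suc (length W)) (+-comm 1 (indicator (mem a W))) (s≤s (indicator-mem-≤ a W))
  ... | no _ | no _ = m≤n⇒m≤1+n (indicator-pair-≤ W a≢b)

  indicator-pair-≤2 : ∀ a b → indicator a + indicator b ≤ 2
  indicator-pair-≤2 true true = ≤-refl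
  indicator-pair-≤2 true false = s≤s z≤n
  indicator-pair-≤2 false true = s≤s z≤n
  indicator-pair-≤2 false false = z≤n

  edgesWithin : List (Fin n) → List (Fin n × Fin n) → List (Fin n × Fin n)
  edgesWithin W [] = []
  edgesWithin W ((u , v) ∷ es) =
    if mem u W ∧ mem v W then (u , v) ∷ edgesWithin W es else edgesWithin W es

  length-if-∷ : ∀ b (e : Fin n × Fin n) r → length (if b then e ∷ r else r) ≡ indicator b + length r
  length-if-∷ true e r = refl
  length-if-∷ false e r = refl

  ∈-edgesWithin : ∀ W es {u v} → (u , v) ∈ es → u ∈ W → v ∈ W → (u , v) ∈ edgesWithin W es
  ∈-edgesWithin W (_ ∷ es) (here refl) u∈ v∈ rewrite mem-complete u∈ | mem-complete v∈ = here refl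
  ∈-edgesWithin W ((u′ , v′) ∷ es) (there p) u∈ v∈ with mem u′ W ∧ mem v′ W
  ... | true = there (∈-edgesWithin W es p u∈ v∈)
  ... | false = ∈-edgesWithin W es p u∈ v∈

  edgesWithin-remove : ∀ {w} W es → (∀ {u v} → (u , v) ∈ es → u ≢ w × v ≢ w) →
                       edgesWithin W es ≡ edgesWithin (remove w W) es
  edgesWithin-remove W [] avoid = refl
  edgesWithin-remove W ((u , v) ∷ es) avoid =
    cong₂ (λ b r → if b then (u , v) ∷ r else r)
      (cong₂ _∧_ (≡-sym (mem-remove W (proj₁ (avoid (here refl)))))
                 (≡-sym (mem-remove W (proj₂ (avoid (here refl))))))
      (edgesWithin-remove W es (λ p → avoid (there p)))

  edgesWithin-new-∉ : ∀ {a b w} W es → w ∉ W →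
                      edgesWithin W ((a , w) ∷ (b , w) ∷ es) ≡ edgesWithin W es
  edgesWithin-new-∉ {a} {b} W es w∉W rewrite mem-∉ w∉W | ∧-zeroʳ (mem a W) | ∧-zeroʳ (mem b W) = refl

  length-edgesWithin-new-∈ : ∀ {a b w} W es → w ∈ W →
    length (edgesWithin W ((a , w) ∷ (b , w) ∷ es))
      ≡ indicator (mem a W) + (indicator (mem b W) + length (edgesWithin W es))
  length-edgesWithin-new-∈ {a} {b} W es w∈W
    rewrite mem-complete w∈W | ∧-identityʳ (mem a W) | ∧-identityʳ (mem b W) =
    trans (length-if-∷ (mem a W) _ _) (cong (indicator (mem a W) +_) (length-if-∷ (mem b W) _ _))

  -- Sparsity: any k distinct vertices span at most 2k − 3 edges of a
  -- triangle-tree (induction on the tree; the last vertex has two edges).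
  sparse : ∀ {vs es} → TT {n} vs es → ∀ W → Unique W → length (edgesWithin W es) ≤ triEdges (length W)
  sparse (root a b a≢b) W _ with mem a W in a∈ | mem b W in b∈
  ... | true | true = triEdges-pos (subst (_≤ length W) (cong₂ (λ p q → indicator p + indicator q) a∈ b∈)
                                                       (indicator-pair-≤ W a≢b))
  ... | true | false = z≤n
  ... | false | _ = z≤n
  sparse (add {vs} {es} t a b w ab w∉) W uW with w ∈? W
  ... | no w∉W = subst (λ l → length l ≤ triEdges (length W)) (≡-sym (edgesWithin-new-∉ W es w∉W)) (sparse t W uW)
  ... | yes w∈W = begin
      length (edgesWithin W ((a , w) ∷ (b , w) ∷ es))
        ≡⟨ length-edgesWithin-new-∈ W es w∈W ⟩
      indicator (mem a W) + (indicator (mem b W) + length (edgesWithin W es))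
        ≡⟨ cong₂ (λ p q → indicator p + (indicator q + length (edgesWithin W es)))
                 (≡-sym (mem-remove W a≢w)) (≡-sym (mem-remove W b≢w)) ⟩
      indicator (mem a W′) + (indicator (mem b W′) + length (edgesWithin W es))
        ≡⟨ cong (λ l → indicator (mem a W′) + (indicator (mem b W′) + length l))
                (edgesWithin-remove W es avoid-w) ⟩
      indicator (mem a W′) + (indicator (mem b W′) + length (edgesWithin W′ es))
        ≡⟨ ≡-sym (+-assoc (indicator (mem a W′)) _ _) ⟩
      (indicator (mem a W′) + indicator (mem b W′)) + length (edgesWithin W′ es)
        ≤⟨ triEdges-grow (length W′) _ _ (indicator-pair-≤2 (mem a W′) (mem b W′))
             (indicator-pair-≤ W′ (tt-looplessₑ t ab)) (sparse t W′ (remove-unique W uW)) ⟩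
      triEdges (suc (length W′))
        ≡⟨ cong triEdges (length-remove W uW w∈W) ⟩
      triEdges (length W) ∎
    where
    open ≤-Reasoning
    W′ : List (Fin n)
    W′ = remove w W
    a≢w : a ≢ w
    a≢w a≡w = w∉ (subst (_∈ vs) a≡w (proj₁ (tt-endpointsₑ t ab)))
    b≢w : b ≢ w
    b≢w b≡w = w∉ (subst (_∈ vs) b≡w (proj₂ (tt-endpointsₑ t ab)))
    avoid-w : ∀ {u v} → (u , v) ∈ es → u ≢ w × v ≢ w
    avoid-w p = (λ u≡w → w∉ (subst (_∈ vs) u≡w (proj₁ (tt-endpoints t p))))
              , (λ v≡w → w∉ (subst (_∈ vs) v≡w (proj₂ (tt-endpoints t p))))

  -- A triangle-subtree K of a triangle-tree H is an induced subgraph: an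
  -- edge of H between vertices of K is an edge of K.  Otherwise K plus that
  -- edge would be 2k − 2 distinct edges of H spanned by the k vertices of K.
  induced : ∀ {V E vs es} → TT {n} V E → TT {n} vs es → (∀ {u v} → (u , v) ∈ₑ E → (u , v) ∈ₑ es) →
            ∀ {u v} → u ∈ V → v ∈ V → (u , v) ∈ₑ es → (u , v) ∈ₑ E
  induced {V} {E} {vs} {es} K H K⊆H {u} {v} u∈V v∈V uv∈H
    with (u , v) ∈E? E | (v , u) ∈E? E
  ... | yes p | _ = inj₁ p
  ... | no _ | yes p = inj₂ p
  ... | no uv∉E | no vu∉E = ⊥-elim (<-irrefl refl too-many)
    where
    new : ∀ {z} → z ∈ E → ¬ SameEdge (u , v) z
    new z∈ (inj₁ refl) = uv∉E z∈
    new z∈ (inj₂ refl) = vu∉E z∈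
    within : ∀ {p q} → (p , q) ∈ₑ es → p ∈ V → q ∈ V → ∃ λ m → m ∈ edgesWithin V es × SameEdge (p , q) m
    within (inj₁ pq) p∈ q∈ = _ , ∈-edgesWithin V es pq p∈ q∈ , inj₁ refl
    within (inj₂ qp) p∈ q∈ = _ , ∈-edgesWithin V es qp q∈ p∈ , inj₂ refl
    cover : ∀ {z} → z ∈ (u , v) ∷ E → ∃ λ m → m ∈ edgesWithin V es × SameEdge z m
    cover (here refl) = within uv∈H u∈V v∈V
    cover (there z∈) = within (K⊆H (inj₁ z∈)) (proj₁ (tt-endpoints K z∈)) (proj₂ (tt-endpoints K z∈))
    too-many : suc (length E) ≤ length E
    too-many = begin
      suc (length E)           ≤⟨ distinct-length SameEdge SameEdge-sym SameEdge-trans ((u , v) ∷ E) _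
                                   (All.tabulate new ∷ tt-edges-distinct K) cover ⟩
      length (edgesWithin V es) ≤⟨ sparse H V (tt-unique K) ⟩
      triEdges (length V)       ≡⟨ ≡-sym (tt-edge-count K) ⟩
      length E                  ∎
      where open ≤-Reasoning

  -- A triangle-tree contains no K₄: the K₄ on a, b, q, w contains the
  -- triangle-tree ab + abq + aqw, which would have to be induced, but
  -- misses the edge bw.
  no-K4 : ∀ {vs es} → TT {n} vs es → ∀ {a b q w} →
          a ≢ b → q ≢ a → q ≢ b → w ≢ a → w ≢ b → w ≢ q →
          (a , b) ∈ₑ es → (a , q) ∈ₑ es → (b , q) ∈ₑ es →
          (a , w) ∈ₑ es → (q , w) ∈ₑ es → (b , w) ∈ₑ es → ⊥
  no-K4 {vs} {es} H {a} {b} {q} {w} a≢b q≢a q≢b w≢a w≢b w≢q ab aq bq aw qw bw =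
    bw∉K (induced K H K⊆H (there (there (there (here refl)))) (here refl) bw)
    where
    Kedges : List (Fin n × Fin n)
    Kedges = (a , w) ∷ (q , w) ∷ (a , q) ∷ (b , q) ∷ (a , b) ∷ []
    K : TT (w ∷ q ∷ a ∷ b ∷ []) Kedges
    K = add (add (root a b a≢b) a b q (inj₁ (here refl))
              (λ { (here e) → q≢a e ; (there (here e)) → q≢b e }))
            a q w (inj₁ (here refl))
              (λ { (here e) → w≢q e ; (there (here e)) → w≢a e ; (there (there (here e))) → w≢b e })
    K⊆H′ : ∀ {u v} → (u , v) ∈ Kedges → (u , v) ∈ₑ es
    K⊆H′ (here refl) = aw
    K⊆H′ (there (here refl)) = qw
    K⊆H′ (there (there (here refl))) = aq
    K⊆H′ (there (there (there (here refl)))) = bq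
    K⊆H′ (there (there (there (there (here refl))))) = ab
    K⊆H : ∀ {u v} → (u , v) ∈ₑ Kedges → (u , v) ∈ₑ es
    K⊆H (inj₁ p) = K⊆H′ p
    K⊆H (inj₂ p) = flipₑ (K⊆H′ p)
    bw∉K : ¬ ((b , w) ∈ₑ Kedges)
    bw∉K (inj₁ (here e)) = a≢b (≡-sym (cong proj₁ e))
    bw∉K (inj₁ (there (here e))) = q≢b (≡-sym (cong proj₁ e))
    bw∉K (inj₁ (there (there (here e)))) = w≢q (cong proj₂ e)
    bw∉K (inj₁ (there (there (there (here e))))) = w≢q (cong proj₂ e)
    bw∉K (inj₁ (there (there (there (there (here e)))))) = w≢b (cong proj₂ e)
    bw∉K (inj₂ (here e)) = w≢a (cong proj₁ e)
    bw∉K (inj₂ (there (here e))) = w≢q (cong proj₁ e)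
    bw∉K (inj₂ (there (there (here e)))) = w≢a (cong proj₁ e)
    bw∉K (inj₂ (there (there (there (here e))))) = w≢b (cong proj₁ e)
    bw∉K (inj₂ (there (there (there (there (here e)))))) = w≢a (cong proj₁ e)

module _ {n : ℕ} where
  added-edge : ∀ {H : EdgeRel n} {vis c d} (p : TPath H vis c d) → ∀ {u v} → Added p u v → H u v
  added-edge (step w _ hc hd _ p) new-c = hc
  added-edge (step w _ hc hd _ p) new-d = hd
  added-edge (step w _ hc hd _ p) (later ad) = added-edge p ad

  transfer : ∀ {H H′ : EdgeRel n} {vis c d} (p : TPath H vis c d) →
             (∀ {u v} → Added p u v → H′ u v) → TPath H′ vis c d
  transfer stop f = stop
  transfer (step w w∉ _ _ nx p) f = step w w∉ (f new-c) (f new-d) nx (transfer p (λ ad → f (later ad)))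

  len-transfer : ∀ {H H′ : EdgeRel n} {vis c d} (p : TPath H vis c d) (f : ∀ {u v} → Added p u v → H′ u v) →
                 len (transfer p f) ≡ len p
  len-transfer stop f = refl
  len-transfer (step _ _ _ _ _ p) f = cong suc (len-transfer p _)

  added-transfer : ∀ {H H′ : EdgeRel n} {vis c d} (p : TPath H vis c d) (f : ∀ {u v} → Added p u v → H′ u v) →
                   ∀ {u v} → Added p u v → Added (transfer p f) u v
  added-transfer (step _ _ _ _ _ p) f new-c = new-c
  added-transfer (step _ _ _ _ _ p) f new-d = new-d
  added-transfer (step _ _ _ _ _ p) f (later ad) = later (added-transfer p _ ad)

  distLe-transfer : ∀ {H H′ : EdgeRel n} {a b u v k} → H′ a b → (dl : DistLe H a b u v k) →
                    (∀ {p q} → Added (PathWithin.path dl) p q → H′ p q) → DistLe H′ a b u v k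
  distLe-transfer {H = H} {a = a} {b} {u} {v} ab dl f = record
    { rootIn = ab
    ; path = transfer P f
    ; short = subst (_≤ _) (≡-sym (len-transfer P f)) (PathWithin.short dl)
    ; contains = contains (PathWithin.contains dl) }
    where
    P : TPath H (a ∷ b ∷ []) a b
    P = PathWithin.path dl
    contains : ∀ {R : Set} → R ⊎ (Added P u v ⊎ Added P v u) →
               R ⊎ (Added (transfer P f) u v ⊎ Added (transfer P f) v u)
    contains (inj₁ r) = inj₁ r
    contains (inj₂ (inj₁ ad)) = inj₂ (inj₁ (added-transfer P f ad))
    contains (inj₂ (inj₂ ad)) = inj₂ (inj₂ (added-transfer P f ad))

  distLe-swap : ∀ {H : EdgeRel n} {a b u v k} → DistLe H a b u v k → DistLe H a b v u k
  distLe-swap dl = record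
    { rootIn = PathWithin.rootIn dl ; path = PathWithin.path dl ; short = PathWithin.short dl
    ; contains = swapped (PathWithin.contains dl) }
    where
    swapped : ∀ {A B C D E F : Set} → ((A × B) ⊎ (C × D)) ⊎ (E ⊎ F) → ((D × C) ⊎ (B × A)) ⊎ (F ⊎ E)
    swapped (inj₁ (inj₁ p)) = inj₁ (inj₂ (swap p))
    swapped (inj₁ (inj₂ p)) = inj₁ (inj₁ (swap p))
    swapped (inj₂ (inj₁ p)) = inj₂ (inj₂ p)
    swapped (inj₂ (inj₂ p)) = inj₂ (inj₁ p)

  distLe-weaken : ∀ {H : EdgeRel n} {a b u v k k′} → DistLe H a b u v k → k ≤ k′ → DistLe H a b u v k′
  distLe-weaken dl k≤k′ = record
    { rootIn = PathWithin.rootIn dl ; path = PathWithin.path dl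
    ; short = ≤-trans (PathWithin.short dl) k≤k′ ; contains = PathWithin.contains dl }

-- Initial segments of triangle-paths rooted at ab, built forwards: a prefix
-- ending in vertex set vis with cd the edge the next triangle must use.
data Prefix {n : ℕ} (H : EdgeRel n) (a b : Fin n) : List (Fin n) → Fin n → Fin n → Set where
  start : Prefix H a b (a ∷ b ∷ []) a b
  extend : ∀ {vis c d} → Prefix H a b vis c d → (w : Fin n) → w ∉ vis → H c w → H d w →
           (next : Bool) → Prefix H a b (w ∷ vis) (if next then c else d) w

module _ {n : ℕ} {H : EdgeRel n} {a b : Fin n} where
  plen : ∀ {vis c d} → Prefix H a b vis c d → ℕ
  plen start = 0
  plen (extend rp _ _ _ _ _) = suc (plen rp)

  _⊕_ : ∀ {vis c d} → Prefix H a b vis c d → TPath H vis c d → TPath H (a ∷ b ∷ []) a b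
  start ⊕ p = p
  extend rp w w∉ hc hd nx ⊕ p = rp ⊕ step w w∉ hc hd nx p

  len-⊕ : ∀ {vis c d} (rp : Prefix H a b vis c d) (p : TPath H vis c d) → len (rp ⊕ p) ≡ plen rp + len p
  len-⊕ start p = refl
  len-⊕ (extend rp _ _ _ _ _) p = trans (len-⊕ rp _) (+-suc (plen rp) (len p))

  added-⊕ : ∀ {vis c d} (rp : Prefix H a b vis c d) (p : TPath H vis c d) {u v} →
            Added p u v → Added (rp ⊕ p) u v
  added-⊕ start p ad = ad
  added-⊕ (extend rp _ _ _ _ _) p ad = added-⊕ rp _ (later ad)

  prefix-ends : ∀ {vis c d} → Prefix H a b vis c d → c ∈ vis × d ∈ vis
  prefix-ends start = here refl , there (here refl)
  prefix-ends (extend rp w _ _ _ true) = there (proj₁ (prefix-ends rp)) , here refl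
  prefix-ends (extend rp w _ _ _ false) = there (proj₂ (prefix-ends rp)) , here refl

  distLe-last : ∀ {vis c d} (rp : Prefix H a b vis c d) (w : Fin n) → w ∉ vis → H c w → H d w →
                H a b → ∀ {k} → suc (plen rp) ≤ k →
                ∀ {u v} → (u , v) ≡ (c , w) ⊎ (u , v) ≡ (d , w) → DistLe H a b u v k
  distLe-last {vis} {c} {d} rp w w∉ hc hd ab {k} ℓ<k which = record
    { rootIn = ab
    ; path = rp ⊕ p
    ; short = subst (_≤ k) (≡-sym (trans (len-⊕ rp p) (+-comm (plen rp) 1))) ℓ<k
    ; contains = inj₂ (inj₁ (added-⊕ rp p (new which))) }
    where
    p : TPath H vis c d
    p = step w w∉ hc hd true stop
    new : ∀ {u v} → (u , v) ≡ (_ , w) ⊎ (u , v) ≡ (_ , w) → Added p u v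
    new (inj₁ refl) = new-c
    new (inj₂ refl) = new-d

foldl-invariant : ∀ {S C : Set} (f : S → C → S) (P : List C → S → Set) →
                  (∀ done c s → c ∉ done → P done s → P (done ++ c ∷ []) (f s c)) →
                  ∀ cs done s → Unique (done ++ cs) → P done s → P (done ++ cs) (foldl f s cs)
foldl-invariant f P preserve [] done s _ p = subst (λ l → P l s) (≡-sym (++-identityʳ done)) p
foldl-invariant f P preserve (c ∷ cs) done s u p =
  subst (λ l → P l (foldl f (f s c) cs)) (++-assoc done (c ∷ []) cs)
    (foldl-invariant f P preserve cs (done ++ c ∷ []) (f s c)
      (subst Unique (≡-sym (++-assoc done (c ∷ []) cs)) u) (preserve done c s (fresh done u) p))
  where
  fresh : ∀ (d : List _) {cs} → Unique (d ++ c ∷ cs) → c ∉ d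
  fresh (u ∷ d) (u∉ ∷ _) (here refl) = All.lookup u∉ (∈-++⁺ʳ d (here refl)) refl
  fresh (u ∷ d) (_ ∷ ud) (there p) = fresh d ud p

module _ {n : ℕ} (π : Permutation′ n) where
  ordered-unique : Unique (ordered π)
  ordered-unique = Unique.map⁺ injective (Unique.allFin⁺ n)
    where
    injective : ∀ {i j} → π ⟨$⟩ˡ i ≡ π ⟨$⟩ˡ j → i ≡ j
    injective {i} {j} e = trans (≡-sym (inverseʳ π)) (trans (cong (π ⟨$⟩ʳ_) e) (inverseʳ π))

  ∈-ordered : ∀ w → w ∈ ordered π
  ∈-ordered w = subst (_∈ ordered π) (inverseˡ π) (∈-map⁺ (π ⟨$⟩ˡ_) (∈-allFin (π ⟨$⟩ʳ w)))

module Rounds {n : ℕ} (G : Graph n) (π : Permutation′ n) where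
  round : State n → State n
  round (st T [] E) = st T [] E
  round (st T ((v , a , b) ∷ Q) E) = foldl (processW G v a b) (st T Q E) (ordered π)

  rounds : ℕ → State n → State n
  rounds zero s = s
  rounds (suc k) s = rounds k (round s)

  rounds-idle : ∀ k {s} → State.queue s ≡ [] → rounds k s ≡ s
  rounds-idle zero _ = refl
  rounds-idle (suc k) {st T [] E} refl = rounds-idle k refl

  run≡rounds : ∀ k s → run G π k s ≡ rounds k s
  run≡rounds zero s = refl
  run≡rounds (suc k) (st T [] E) = ≡-sym (rounds-idle k refl)
  run≡rounds (suc k) (st T (e ∷ Q) E) = run≡rounds k _

  rounds-+ : ∀ k l s → rounds (k + l) s ≡ rounds l (rounds k s)
  rounds-+ zero l s = refl
  rounds-+ (suc k) l s = rounds-+ k l (round s)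

  Reaches : State n → State n → Set
  Reaches s s′ = Σ ℕ λ k → rounds k s ≡ s′

  reaches-refl : ∀ s → Reaches s s
  reaches-refl s = 0 , refl

  reaches-round : ∀ s → Reaches s (round s)
  reaches-round s = 1 , refl

  reaches-trans : ∀ {s₁ s₂ s₃} → Reaches s₁ s₂ → Reaches s₂ s₃ → Reaches s₁ s₃
  reaches-trans (k , refl) (l , refl) = k + l , rounds-+ k l _

  edges-round : ∀ s {e} → e ∈ State.edges s → e ∈ State.edges (round s)
  edges-round (st T [] E) p = p
  edges-round (st T ((v , a , b) ∷ Q) E) {e} p =
    foldl-invariant (processW G v a b) (λ _ s′ → e ∈ State.edges s′) keeps (ordered π) [] (st T Q E)
      (ordered-unique π) p
    where
    keeps : ∀ d c s′ → c ∉ d → e ∈ State.edges s′ → e ∈ State.edges (processW G v a b s′ c)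
    keeps d c (st T′ Q′ E′) _ q with mem c T′
    ... | true = q
    ... | false with adj G a c ∧ adj G v c
    ... | true = there (there q)
    ... | false with adj G b c ∧ adj G v c
    ... | true = there (there q)
    ... | false = q

  edges-reaches : ∀ {s s′} → Reaches s s′ → ∀ {e} → e ∈ State.edges s → e ∈ State.edges s′
  edges-reaches (zero , refl) p = p
  edges-reaches {s} (suc k , refl) p = edges-reaches (k , refl) (edges-round s p)

-- Queue items (v , a , b): vertex v waiting to be processed, with base ab.
Item : ℕ → Set
Item n = Fin n × Fin n × Fin n

SameVertex : ∀ {n} → Item n → Item n → Set
SameVertex e e′ = proj₁ e ≡ proj₁ e′

module Invariants {n : ℕ} (G : Graph n) (x y : Fin n) (xy : Edge G x y) where
  Edges : Set
  Edges = List (Fin n × Fin n)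

  OnlyNeighbours : Edges → Fin n → Fin n → Fin n → Set
  OnlyNeighbours E q a b = ∀ u → (u , q) ∈ₑ E → u ≡ a ⊎ u ≡ b

  record Sound (k : ℕ) (T : List (Fin n)) (E : Edges) : Set where
    field
      tree : TT T E
      near : ∀ {u v} → (u , v) ∈ₑ E → DistLe (Edge G) x y u v k
      inG : ∀ {u v} → (u , v) ∈ₑ E → Edge G u v

  record Queued (ℓ : ℕ) (T : List (Fin n)) (E : Edges) (q a b : Fin n) : Set where
    field
      q∈T : q ∈ T
      ab∈E : (a , b) ∈ₑ E
      aq∈E : (a , q) ∈ₑ E
      bq∈E : (b , q) ∈ₑ E
      aq∈G : Edge G a q
      bq∈G : Edge G b q
      vis : List (Fin n)
      prefix : Prefix (Edge G) x y vis a b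
      prefix-len : plen prefix ≡ ℓ
      vis⊆T : ∀ {z} → z ∈ vis → z ∈ T
      q∉vis : q ∉ vis
      only : OnlyNeighbours E q a b

    a∈T : a ∈ T
    a∈T = vis⊆T (proj₁ (prefix-ends prefix))

    b∈T : b ∈ T
    b∈T = vis⊆T (proj₂ (prefix-ends prefix))

  queued-mono : ∀ {ℓ T E T′ E′ q a b} → Queued ℓ T E q a b →
                (∀ {z} → z ∈ T → z ∈ T′) → (∀ {e} → e ∈ E → e ∈ E′) →
                OnlyNeighbours E′ q a b → Queued ℓ T′ E′ q a b
  queued-mono Q T⊆ E⊆ only′ = record
    { q∈T = T⊆ q∈T ; ab∈E = ∈ₑ-mono E⊆ ab∈E ; aq∈E = ∈ₑ-mono E⊆ aq∈E ; bq∈E = ∈ₑ-mono E⊆ bq∈E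
    ; aq∈G = aq∈G ; bq∈G = bq∈G ; vis = vis ; prefix = prefix ; prefix-len = prefix-len
    ; vis⊆T = λ p → T⊆ (vis⊆T p) ; q∉vis = q∉vis ; only = only′ }
    where open Queued Q

  only-extend : ∀ {E r a b c d w} → OnlyNeighbours E r a b → r ≢ w → r ≢ c → r ≢ d →
                OnlyNeighbours ((c , w) ∷ (d , w) ∷ E) r a b
  only-extend old r≢w r≢c r≢d u (inj₁ (here e)) = ⊥-elim (r≢w (cong proj₂ e))
  only-extend old r≢w r≢c r≢d u (inj₁ (there (here e))) = ⊥-elim (r≢w (cong proj₂ e))
  only-extend old r≢w r≢c r≢d u (inj₁ (there (there p))) = old u (inj₁ p)
  only-extend old r≢w r≢c r≢d u (inj₂ (here e)) = ⊥-elim (r≢c (cong proj₁ e))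
  only-extend old r≢w r≢c r≢d u (inj₂ (there (here e))) = ⊥-elim (r≢d (cong proj₁ e))
  only-extend old r≢w r≢c r≢d u (inj₂ (there (there p))) = old u (inj₂ p)

  module AddTriangle {k T E c d vis} (S : Sound k T E) (cd∈E : (c , d) ∈ₑ E)
                     (rp : Prefix (Edge G) x y vis c d) (vis⊆T : ∀ {z} → z ∈ vis → z ∈ T)
                     (short : suc (plen rp) ≤ k)
                     (w : Fin n) (w∉T : w ∉ T) (cw : Edge G c w) (dw : Edge G d w) where
    open Sound S

    E⁺ : Edges
    E⁺ = (c , w) ∷ (d , w) ∷ E

    w∉vis : w ∉ vis
    w∉vis p = w∉T (vis⊆T p)

    ≢w : ∀ {z} → z ∈ T → z ≢ w
    ≢w z∈T refl = w∉T z∈T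

    c≢w : c ≢ w
    c≢w = ≢w (vis⊆T (proj₁ (prefix-ends rp)))

    d≢w : d ≢ w
    d≢w = ≢w (vis⊆T (proj₂ (prefix-ends rp)))

    new-near : ∀ {u v} → (u , v) ≡ (c , w) ⊎ (u , v) ≡ (d , w) → DistLe (Edge G) x y u v k
    new-near = distLe-last rp w w∉vis cw dw xy short

    sound⁺ : Sound k (w ∷ T) E⁺
    sound⁺ = record { tree = add tree c d w cd∈E w∉T ; near = near⁺ ; inG = inG⁺ }
      where
      near⁺ : ∀ {u v} → (u , v) ∈ₑ E⁺ → DistLe (Edge G) x y u v k
      near⁺ (inj₁ (here refl)) = new-near (inj₁ refl)
      near⁺ (inj₁ (there (here refl))) = new-near (inj₂ refl)
      near⁺ (inj₁ (there (there p))) = near (inj₁ p)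
      near⁺ (inj₂ (here refl)) = distLe-swap (new-near (inj₁ refl))
      near⁺ (inj₂ (there (here refl))) = distLe-swap (new-near (inj₂ refl))
      near⁺ (inj₂ (there (there p))) = near (inj₂ p)
      inG⁺ : ∀ {u v} → (u , v) ∈ₑ E⁺ → Edge G u v
      inG⁺ (inj₁ (here refl)) = cw
      inG⁺ (inj₁ (there (here refl))) = dw
      inG⁺ (inj₁ (there (there p))) = inG (inj₁ p)
      inG⁺ (inj₂ (here refl)) = trans (Graph.sym G w c) cw
      inG⁺ (inj₂ (there (here refl))) = trans (Graph.sym G w d) dw
      inG⁺ (inj₂ (there (there p))) = inG (inj₂ p)

    queued⁺ : Queued (plen rp) (w ∷ T) E⁺ w c d
    queued⁺ = record
      { q∈T = here refl ; ab∈E = ∈ₑ-mono (λ p → there (there p)) cd∈E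
      ; aq∈E = inj₁ (here refl) ; bq∈E = inj₁ (there (here refl)) ; aq∈G = cw ; bq∈G = dw
      ; vis = vis ; prefix = rp ; prefix-len = refl ; vis⊆T = λ p → there (vis⊆T p)
      ; q∉vis = w∉vis ; only = only⁺ }
      where
      only⁺ : OnlyNeighbours E⁺ w c d
      only⁺ u (inj₁ (here e)) = inj₁ (cong proj₁ e)
      only⁺ u (inj₁ (there (here e))) = inj₂ (cong proj₁ e)
      only⁺ u (inj₁ (there (there p))) = ⊥-elim (w∉T (proj₂ (tt-endpoints tree p)))
      only⁺ u (inj₂ (here e)) = ⊥-elim (c≢w (≡-sym (cong proj₁ e)))
      only⁺ u (inj₂ (there (here e))) = ⊥-elim (d≢w (≡-sym (cong proj₁ e)))
      only⁺ u (inj₂ (there (there p))) = ⊥-elim (w∉T (proj₁ (tt-endpoints tree p)))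

    keep : ∀ {ℓ r a b} → Queued ℓ T E r a b → r ≢ c → r ≢ d → Queued ℓ (w ∷ T) E⁺ r a b
    keep Q r≢c r≢d = queued-mono Q there (λ p → there (there p))
                       (only-extend (Queued.only Q) (≢w (Queued.q∈T Q)) r≢c r≢d)

  common : Fin n → Fin n → Fin n → Bool
  common a q w = adj G a w ∧ adj G q w

  Chosen : Fin n → Fin n → Fin n → Fin n → Fin n → Set
  Chosen a b q w c = (c ≡ a × common a q w ≡ true) ⊎ (c ≡ b × common a q w ≡ false × common b q w ≡ true)

  chosen-base : ∀ {a b q w c} → Chosen a b q w c → c ≡ a ⊎ c ≡ b
  chosen-base (inj₁ (c≡a , _)) = inj₁ c≡a
  chosen-base (inj₂ (c≡b , _)) = inj₂ c≡b

  record Invariant (h : ℕ) (A B : List (Item n)) (s : State n) : Set where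
    field
      queue≡ : State.queue s ≡ A ++ B
      levelA : ∀ {q a b} → (q , a , b) ∈ A → Queued h (State.inTree s) (State.edges s) q a b
      levelB : ∀ {q a b} → (q , a , b) ∈ B → Queued (suc h) (State.inTree s) (State.edges s) q a b
      distinct : Distinct SameVertex (State.queue s)
      bases-unqueued : ∀ {q a b e} → (q , a , b) ∈ State.queue s → e ∈ State.queue s →
                       proj₁ e ≢ a × proj₁ e ≢ b
      sound : Sound (suc (suc h)) (State.inTree s) (State.edges s)

  module Process {h T₀ E₀} (Q₀ : List (Item n)) {q a b} (head : Queued h T₀ E₀ q a b)
                 (S₀ : Sound (suc (suc h)) T₀ E₀)
                 (Q₀-apart : ∀ {r a′ b′} → (r , a′ , b′) ∈ Q₀ → r ≢ q × r ≢ a × r ≢ b) where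

    record Progress (done : List (Fin n)) (s : State n) : Set where
      field
        new : List (Item n)
        queue≡ : State.queue s ≡ Q₀ ++ new
        T₀⊆T : ∀ {z} → z ∈ T₀ → z ∈ State.inTree s
        E₀⊆E : ∀ {e} → e ∈ E₀ → e ∈ State.edges s
        grown : ∀ {z} → z ∈ State.inTree s → z ∈ T₀ ⊎ z ∈ done
        shape : ∀ {e} → e ∈ new → ∃₂ λ w c → e ≡ (w , c , q) × (c ≡ a ⊎ c ≡ b) × w ∉ T₀ × w ∈ State.inTree s
        new-queued : ∀ {w c d} → (w , c , d) ∈ new → Queued (suc h) (State.inTree s) (State.edges s) w c d
        old-queued : ∀ {ℓ r a′ b′} → (r , a′ , b′) ∈ Q₀ → Queued ℓ T₀ E₀ r a′ b′ →
                     Queued ℓ (State.inTree s) (State.edges s) r a′ b′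
        new-distinct : Distinct SameVertex new
        sound : Sound (suc (suc h)) (State.inTree s) (State.edges s)
        complete : ∀ {w} → w ∈ done → w ∉ T₀ → (common a q w ≡ true ⊎ common b q w ≡ true) →
                   ∃ λ c → (w , c , q) ∈ new × Chosen a b q w c
        count : length (State.queue s) + length T₀ ≡ length Q₀ + length (State.inTree s)

    progress-start : Progress [] (st T₀ Q₀ E₀)
    progress-start = record
      { new = [] ; queue≡ = ≡-sym (++-identityʳ Q₀) ; T₀⊆T = λ p → p ; E₀⊆E = λ p → p ; grown = inj₁
      ; shape = λ () ; new-queued = λ () ; old-queued = λ _ Q → Q ; new-distinct = []
      ; sound = S₀ ; complete = λ () ; count = refl }

    skip : ∀ {done s} w → Progress done s →
           (w ∉ T₀ → (common a q w ≡ true ⊎ common b q w ≡ true) → ⊥) → Progress (done ++ w ∷ []) s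
    skip {done} w P no-add = record
      { new = new ; queue≡ = queue≡ ; T₀⊆T = T₀⊆T ; E₀⊆E = E₀⊆E
      ; grown = λ p → Data.Sum.map₂ ∈-++⁺ˡ (grown p)
      ; shape = shape ; new-queued = new-queued ; old-queued = old-queued ; new-distinct = new-distinct
      ; sound = sound ; complete = complete′ ; count = count }
      where
      open Progress P
      complete′ : ∀ {w′} → w′ ∈ done ++ w ∷ [] → w′ ∉ T₀ → (common a q w′ ≡ true ⊎ common b q w′ ≡ true) →
                  ∃ λ c → (w′ , c , q) ∈ new × Chosen a b q w′ c
      complete′ p w′∉ cond with ∈-++⁻ done p
      ... | inj₁ p′ = complete p′ w′∉ cond
      ... | inj₂ (here refl) = ⊥-elim (no-add w′∉ cond)

    module H = Queued head

    prefix-to : ∀ {c} → c ≡ a ⊎ c ≡ b → Prefix (Edge G) x y (q ∷ H.vis) c q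
    prefix-to (inj₁ refl) = extend H.prefix q H.q∉vis H.aq∈G H.bq∈G true
    prefix-to (inj₂ refl) = extend H.prefix q H.q∉vis H.aq∈G H.bq∈G false

    plen-prefix-to : ∀ {c} (c∈ab : c ≡ a ⊎ c ≡ b) → plen (prefix-to c∈ab) ≡ suc h
    plen-prefix-to (inj₁ refl) = cong suc H.prefix-len
    plen-prefix-to (inj₂ refl) = cong suc H.prefix-len

    cq∈E₀ : ∀ {c} → c ≡ a ⊎ c ≡ b → (c , q) ∈ₑ E₀
    cq∈E₀ (inj₁ refl) = H.aq∈E
    cq∈E₀ (inj₂ refl) = H.bq∈E

    c∈T₀ : ∀ {c} → c ≡ a ⊎ c ≡ b → c ∈ T₀
    c∈T₀ (inj₁ refl) = H.a∈T
    c∈T₀ (inj₂ refl) = H.b∈T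

    chosen-common : ∀ {w c} → Chosen a b q w c → common c q w ≡ true
    chosen-common (inj₁ (refl , e)) = e
    chosen-common (inj₂ (refl , _ , e)) = e

    module Adding {done T Q E} (P : Progress done (st T Q E)) (w c : Fin n) (w∉T : w ∉ T)
                  (ch : Chosen a b q w c) where
      open Progress P

      item : Item n
      item = (w , c , q)

      c∈ab : c ≡ a ⊎ c ≡ b
      c∈ab = chosen-base ch

      w∉T₀ : w ∉ T₀
      w∉T₀ p = w∉T (T₀⊆T p)

      vis⊆T : ∀ {z} → z ∈ q ∷ H.vis → z ∈ T
      vis⊆T (here refl) = T₀⊆T H.q∈T
      vis⊆T (there p) = T₀⊆T (H.vis⊆T p)

      open AddTriangle sound (∈ₑ-mono E₀⊆E (cq∈E₀ c∈ab)) (prefix-to c∈ab) vis⊆T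
             (≤-reflexive (cong suc (plen-prefix-to c∈ab))) w w∉T
             (∧-conicalˡ _ _ (chosen-common ch)) (∧-conicalʳ _ _ (chosen-common ch)) public

      vertex∈T : ∀ {e} → e ∈ new → proj₁ e ∈ T
      vertex∈T i with shape i
      ... | _ , _ , refl , _ , _ , w′∈T = w′∈T

      grown⁺ : ∀ {z} → z ∈ w ∷ T → z ∈ T₀ ⊎ z ∈ done ++ w ∷ []
      grown⁺ (here refl) = inj₂ (∈-++⁺ʳ done (here refl))
      grown⁺ (there p) = Data.Sum.map₂ ∈-++⁺ˡ (grown p)

      shape⁺ : ∀ {e} → e ∈ new ++ item ∷ [] →
               ∃₂ λ w′ c′ → e ≡ (w′ , c′ , q) × (c′ ≡ a ⊎ c′ ≡ b) × w′ ∉ T₀ × w′ ∈ w ∷ T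
      shape⁺ i with ∈-++⁻ new i
      ... | inj₂ (here refl) = w , c , refl , c∈ab , w∉T₀ , here refl
      ... | inj₁ i′ with shape i′
      ... | w′ , c′ , e≡ , c′∈ab , w′∉T₀ , w′∈T = w′ , c′ , e≡ , c′∈ab , w′∉T₀ , there w′∈T

      -- the new item is at level h + 1; the earlier new vertices lie outside T₀ ∋ c, q
      new-queued⁺ : ∀ {w′ c′ d′} → (w′ , c′ , d′) ∈ new ++ item ∷ [] → Queued (suc h) (w ∷ T) E⁺ w′ c′ d′
      new-queued⁺ i with ∈-++⁻ new i
      ... | inj₂ (here refl) = subst (λ ℓ → Queued ℓ _ _ w c q) (plen-prefix-to c∈ab) queued⁺
      ... | inj₁ i′ with shape i′
      ... | _ , _ , refl , _ , w′∉T₀ , _ =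
        keep (new-queued i′) (λ e → w′∉T₀ (subst (_∈ T₀) (≡-sym e) (c∈T₀ c∈ab)))
                             (λ e → w′∉T₀ (subst (_∈ T₀) (≡-sym e) H.q∈T))

      -- the old items avoid q, a and b, hence c
      old-queued⁺ : ∀ {ℓ r a′ b′} → (r , a′ , b′) ∈ Q₀ → Queued ℓ T₀ E₀ r a′ b′ → Queued ℓ (w ∷ T) E⁺ r a′ b′
      old-queued⁺ i Qr with Q₀-apart i
      ... | r≢q , r≢a , r≢b = keep (old-queued i Qr) (≢-either r≢a r≢b c∈ab) r≢q

      new-distinct⁺ : Distinct SameVertex (new ++ item ∷ [])
      new-distinct⁺ = AllPairs.++⁺ new-distinct ([] ∷ [])
                        (All.tabulate (λ i → (λ e → w∉T (subst (_∈ T) e (vertex∈T i))) ∷ []))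

      complete⁺ : ∀ {w′} → w′ ∈ done ++ w ∷ [] → w′ ∉ T₀ → (common a q w′ ≡ true ⊎ common b q w′ ≡ true) →
                  ∃ λ c′ → (w′ , c′ , q) ∈ new ++ item ∷ [] × Chosen a b q w′ c′
      complete⁺ p w′∉ cond with ∈-++⁻ done p
      ... | inj₁ p′ = let (c′ , i , ch′) = complete p′ w′∉ cond in c′ , ∈-++⁺ˡ i , ch′
      ... | inj₂ (here refl) = c , ∈-++⁺ʳ new (here refl) , ch

    adding : ∀ {done T Q E} w c → Progress done (st T Q E) → w ∉ T → Chosen a b q w c →
             Progress (done ++ w ∷ []) (st (w ∷ T) (Q ++ (w , c , q) ∷ []) ((c , w) ∷ (q , w) ∷ E))
    adding {Q = Q} w c P w∉T ch = record
      { new = new ++ item ∷ []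
      ; queue≡ = trans (cong (_++ item ∷ []) queue≡) (++-assoc Q₀ new (item ∷ []))
      ; T₀⊆T = λ p → there (T₀⊆T p)
      ; E₀⊆E = λ p → there (there (E₀⊆E p))
      ; grown = grown⁺
      ; shape = shape⁺
      ; new-queued = new-queued⁺
      ; old-queued = old-queued⁺
      ; new-distinct = new-distinct⁺
      ; sound = sound⁺
      ; complete = complete⁺
      ; count = length-snoc Q item count }
      where
      open Progress P
      open Adding P w c w∉T ch

    progress-step : ∀ done w s → w ∉ done → Progress done s →
                    Progress (done ++ w ∷ []) (processW G q a b s w)
    progress-step done w (st T Q E) w∉done P with mem w T in w∈T
    ... | true = skip w P (λ w∉T₀ _ → [ w∉T₀ , w∉done ]′ (Progress.grown P (mem-sound T w∈T)))
    ... | false with common a q w in ca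
    ... | true = adding w a P (mem-false T w∈T) (inj₁ (refl , ca))
    ... | false with common b q w in cb
    ... | true = adding w b P (mem-false T w∈T) (inj₂ (refl , ca , cb))
    ... | false = skip w P neither
      where
      neither : w ∉ T₀ → (common a q w ≡ true ⊎ common b q w ≡ true) → ⊥
      neither _ (inj₁ e) with trans (≡-sym ca) e
      ... | ()
      neither _ (inj₂ e) with trans (≡-sym cb) e
      ... | ()

    processed : (π : Permutation′ n) →
                Progress (ordered π) (foldl (processW G q a b) (st T₀ Q₀ E₀) (ordered π))
    processed π = foldl-invariant (processW G q a b) Progress progress-step (ordered π) []
                    (st T₀ Q₀ E₀) (ordered-unique π) progress-start

  record RoundResult (π : Permutation′ n) (h : ℕ) (A B : List (Item n)) (s : State n) (q a b : Fin n) : Set where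
    open Rounds G π
    field
      new : List (Item n)
      invariant : Invariant h A (B ++ new) (round s)
      complete : ∀ {w} → w ∉ State.inTree s → (common a q w ≡ true ⊎ common b q w ≡ true) →
                 ∃ λ c → (w , c , q) ∈ new × Chosen a b q w c
      count : length (State.queue (round s)) + suc (length (State.inTree s))
                ≡ length (State.queue s) + length (State.inTree (round s))

  module RoundFrom (π : Permutation′ n) {h q a b A B T₀ E₀}
                   (inv : Invariant h ((q , a , b) ∷ A) B (st T₀ ((q , a , b) ∷ A ++ B) E₀)) where
    module I = Invariant inv

    Q₀ : List (Item n)
    Q₀ = A ++ B

    old-distinct : Distinct SameVertex Q₀
    old-distinct with I.distinct
    ... | _ ∷ d = d

    Q₀-apart : ∀ {r a′ b′} → (r , a′ , b′) ∈ Q₀ → r ≢ q × r ≢ a × r ≢ b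
    Q₀-apart o with I.distinct
    ... | q∉ ∷ _ = (λ e → All.lookup q∉ o (≡-sym e)) , I.bases-unqueued (here refl) (there o)

    open Process Q₀ (I.levelA (here refl)) I.sound Q₀-apart public
    open Progress (processed π) public

    old-level : ∀ {e} → e ∈ Q₀ → Σ ℕ λ ℓ → Queued ℓ T₀ E₀ (proj₁ e) (proj₁ (proj₂ e)) (proj₂ (proj₂ e))
    old-level o with ∈-++⁻ A o
    ... | inj₁ o′ = h , I.levelA (there o′)
    ... | inj₂ o′ = suc h , I.levelB o′

    old∈T₀ : ∀ {e} → e ∈ Q₀ → proj₁ e ∈ T₀
    old∈T₀ o = Queued.q∈T (proj₂ (old-level o))

    new∉T₀ : ∀ {e} → e ∈ new → proj₁ e ∉ T₀
    new∉T₀ i with shape i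
    ... | _ , _ , refl , _ , w∉T₀ , _ = w∉T₀

    levelB⁺ : ∀ {r a′ b′} → (r , a′ , b′) ∈ B ++ new → Queued (suc h) _ _ r a′ b′
    levelB⁺ p with ∈-++⁻ B p
    ... | inj₁ o = old-queued (∈-++⁺ʳ A o) (I.levelB o)
    ... | inj₂ i = new-queued i

    distinct⁺ : Distinct SameVertex (Q₀ ++ new)
    distinct⁺ = AllPairs.++⁺ old-distinct new-distinct
                  (All.tabulate (λ o → All.tabulate (λ i e → new∉T₀ i (subst (_∈ T₀) e (old∈T₀ o)))))

    -- Bases of old items are in T₀, so they are no new vertices; the bases
    -- c, q of new items are in T₀ too, and differ from the old vertices
    -- because c ∈ {a, b} and q was the head.
    bases-unqueued⁺ : ∀ {r a′ b′ e} → (r , a′ , b′) ∈ Q₀ ++ new → e ∈ Q₀ ++ new → proj₁ e ≢ a′ × proj₁ e ≢ b′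
    bases-unqueued⁺ p p′ with ∈-++⁻ Q₀ p | ∈-++⁻ Q₀ p′
    ... | inj₁ o | inj₁ o′ = I.bases-unqueued (there o) (there o′)
    ... | inj₁ o | inj₂ i′ = (λ e → new∉T₀ i′ (subst (_∈ T₀) (≡-sym e) (Queued.a∈T (proj₂ (old-level o)))))
                           , (λ e → new∉T₀ i′ (subst (_∈ T₀) (≡-sym e) (Queued.b∈T (proj₂ (old-level o)))))
    ... | inj₂ i | p″ with shape i
    ... | _ , c , refl , c∈ab , _ , _ with p″
    ... | inj₂ i′ = (λ e → new∉T₀ i′ (subst (_∈ T₀) (≡-sym e) (c∈T₀ c∈ab)))
                  , (λ e → new∉T₀ i′ (subst (_∈ T₀) (≡-sym e) H.q∈T))
    ... | inj₁ o′ with Q₀-apart o′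
    ... | r≢q , r≢a , r≢b = ≢-either r≢a r≢b c∈ab , r≢q

  round-result : ∀ (π : Permutation′ n) {h q a b A B} s → Invariant h ((q , a , b) ∷ A) B s →
                 RoundResult π h A B s q a b
  round-result π {A = A} {B} (st T₀ _ E₀) inv with Invariant.queue≡ inv
  ... | refl = record
    { new = new
    ; invariant = record
      { queue≡ = trans queue≡ (++-assoc A B new)
      ; levelA = λ p → old-queued (∈-++⁺ˡ p) (I.levelA (there p))
      ; levelB = levelB⁺
      ; distinct = subst (Distinct SameVertex) (≡-sym queue≡) distinct⁺
      ; bases-unqueued = λ p p′ → bases-unqueued⁺ (subst (_ ∈_) queue≡ p) (subst (_ ∈_) queue≡ p′)
      ; sound = sound }
    ; complete = λ w∉ cond → complete (∈-ordered π _) w∉ cond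
    ; count = trans (+-suc _ _) (cong suc count) }
    where open RoundFrom π inv

module Fairness {n : ℕ} (G : Graph n) (π : Permutation′ n) (x y : Fin n) (xy : Edge G x y) where
  open Invariants G x y xy
  open Rounds G π

  level-up : ∀ {h B s} → Invariant h [] B s → Invariant (suc h) B [] s
  level-up {B = B} inv = record
    { queue≡ = trans queue≡ (≡-sym (++-identityʳ B)) ; levelA = levelB ; levelB = λ ()
    ; distinct = distinct ; bases-unqueued = bases-unqueued
    ; sound = record { tree = Sound.tree sound ; inG = Sound.inG sound
                     ; near = λ p → distLe-weaken (Sound.near sound p) (n≤1+n _) } }
    where open Invariant inv

  Good : State n → Set
  Good s = Σ ℕ λ h → Σ (List (Item n)) λ A → Σ (List (Item n)) λ B → Invariant h A B s

  current-head : ∀ s → Good s → State.queue s ≢ [] →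
                 Σ ℕ λ h → ∃ λ q → ∃ λ a → ∃ λ b → ∃ λ A → ∃ λ B → Invariant h ((q , a , b) ∷ A) B s
  current-head s (h , (q , a , b) ∷ A , B , inv) _ = h , q , a , b , A , B , inv
  current-head s (h , [] , (q , a , b) ∷ B , inv) _ = suc h , q , a , b , B , [] , level-up inv
  current-head (st T Q E) (h , [] , [] , inv) Q≢[] = ⊥-elim (Q≢[] (Invariant.queue≡ inv))

  good-round : ∀ s → Good s → Good (round s)
  good-round (st T [] E) g = g
  good-round s@(st T (_ ∷ _) E) g with current-head s g (λ ())
  ... | h , q , a , b , A , B , inv = h , A , _ , RoundResult.invariant (round-result π s inv)

  good-rounds : ∀ k s → Good s → Good (rounds k s)
  good-rounds zero s g = g
  good-rounds (suc k) s g = good-rounds k (round s) (good-round s g)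

  serve-current : ∀ {h A B t} s → Invariant h A B s → t ∈ A →
                  Σ (State n) λ s′ → Reaches s s′ × ∃ λ A′ → ∃ λ B′ → Invariant h (t ∷ A′) B′ s′
  serve-current {A = _ ∷ A} s inv (here refl) = s , reaches-refl s , A , _ , inv
  serve-current {A = (q , a , b) ∷ A} s inv (there p)
    with serve-current (round s) (RoundResult.invariant (round-result π s inv)) p
  ... | s′ , r , A′ , B′ , inv′ = s′ , reaches-trans (reaches-round s) r , A′ , B′ , inv′

  exhaust : ∀ {h A B t} s → Invariant h A B s → t ∈ B →
            Σ (State n) λ s′ → Reaches s s′ × ∃ λ B′ → t ∈ B′ × Invariant h [] B′ s′
  exhaust {A = []} s inv p = s , reaches-refl s , _ , p , inv
  exhaust {A = (q , a , b) ∷ A} s inv p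
    with exhaust (round s) (RoundResult.invariant (round-result π s inv)) (∈-++⁺ˡ p)
  ... | s′ , r , B′ , p′ , inv′ = s′ , reaches-trans (reaches-round s) r , B′ , p′ , inv′

  serve-next : ∀ {h A B t} s → Invariant h A B s → t ∈ B →
               Σ (State n) λ s′ → Reaches s s′ × ∃ λ A′ → ∃ λ B′ → Invariant (suc h) (t ∷ A′) B′ s′
  serve-next s inv p with exhaust s inv p
  ... | s₁ , r₁ , B′ , p′ , inv₁ with serve-current s₁ (level-up inv₁) p′
  ... | s₂ , r₂ , A′ , B″ , inv₂ = s₂ , reaches-trans r₁ r₂ , A′ , B″ , inv₂

  tree-size : ∀ {T E} → TT {n} T E → length T ≤ n
  tree-size {T} t = subst (length T ≤_) (length-tabulate (λ i → i))
    (distinct-length _≡_ ≡-sym trans T (L.allFin n) (tt-unique t) (λ {z} _ → z , ∈-allFin z , refl))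

  round-count : ∀ s → Good s → State.queue s ≢ [] →
                length (State.queue (round s)) + suc (length (State.inTree s))
                  ≡ length (State.queue s) + length (State.inTree (round s))
  round-count s g Q≢[] with current-head s g Q≢[]
  ... | h , q , a , b , A , B , inv = RoundResult.count (round-result π s inv)

  -- Termination: the queue length plus the number of vertices outside the
  -- tree drops by one per round, so k rounds empty the queue as soon as
  -- |Q| + n ≤ |T| + k.
  terminates : ∀ k s → Good s → length (State.queue s) + n ≤ length (State.inTree s) + k →
               State.queue (rounds k s) ≡ []
  terminates zero (st T [] E) g bound = refl
  terminates zero (st T (e ∷ Q) E) (h , A , B , inv) bound =
    ⊥-elim (<-irrefl refl (begin-strict
      n                     <⟨ s≤s (m≤n+m n (length Q)) ⟩
      length (e ∷ Q) + n    ≤⟨ bound ⟩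
      length T + 0          ≡⟨ +-identityʳ (length T) ⟩
      length T              ≤⟨ tree-size (Sound.tree (Invariant.sound inv)) ⟩
      n                     ∎))
    where open ≤-Reasoning
  terminates (suc k) (st T [] E) g bound = cong State.queue (rounds-idle k refl)
  terminates (suc k) s@(st T (e ∷ Q) E) g bound =
    terminates k (round s) (good-round s g) (+-cancelʳ-≤ (suc (length T)) _ _ (begin
      (Q′ + n) + suc (length T)      ≡⟨ rearrange Q′ n (length T) ⟩
      (Q′ + suc (length T)) + n      ≡⟨ cong (_+ n) (round-count s g (λ ())) ⟩
      (length (e ∷ Q) + T′) + n      ≡⟨ rearrange′ (length (e ∷ Q)) T′ n ⟩
      (length (e ∷ Q) + n) + T′      ≤⟨ +-monoˡ-≤ T′ bound ⟩
      (length T + suc k) + T′        ≡⟨ rearrange″ (length T) k T′ ⟩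
      (T′ + k) + suc (length T)      ∎))
    where
    open ≤-Reasoning
    Q′ T′ : ℕ
    Q′ = length (State.queue (round s))
    T′ = length (State.inTree (round s))
    rearrange : ∀ a b c → (a + b) + suc c ≡ (a + suc c) + b
    rearrange = solve-∀
    rearrange′ : ∀ a b c → (a + b) + c ≡ (a + c) + b
    rearrange′ = solve-∀
    rearrange″ : ∀ a b c → (a + suc b) + c ≡ (c + b) + suc a
    rearrange″ = solve-∀

module Start {n : ℕ} (G : Graph n) (π : Permutation′ n) (x y : Fin n) (xy : Edge G x y) where
  open Invariants G x y xy

  loopless : ∀ {u v} → Edge G u v → u ≢ v
  loopless {u} e refl with trans (≡-sym e) (irrefl G u)
  ... | ()

  record Seeded (done : List (Fin n)) (s : State n) : Set where
    field
      queued : ∀ {z a b} → (z , a , b) ∈ State.queue s → Queued 0 (State.inTree s) (State.edges s) z a b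
      base-xy : ∀ {e} → e ∈ State.queue s → ∃ λ z → e ≡ (z , x , y)
      distinct : Distinct SameVertex (State.queue s)
      grown : ∀ {z} → z ∈ State.inTree s → z ≡ x ⊎ z ≡ y ⊎ z ∈ done
      x∈T : x ∈ State.inTree s
      y∈T : y ∈ State.inTree s
      xy∈E : (x , y) ∈ State.edges s
      sound : Sound 2 (State.inTree s) (State.edges s)
      complete : ∀ {z} → z ∈ done → common x y z ≡ true → (z , x , y) ∈ State.queue s
      count : length (State.queue s) + 2 ≡ length (State.inTree s)

  seed : State n → Fin n → State n
  seed s z = if adj G x z ∧ adj G y z
             then st (z ∷ State.inTree s) (State.queue s ++ ((z , x , y) ∷ []))
                     ((x , z) ∷ (y , z) ∷ State.edges s)
             else s

  seeded-start : Seeded [] (st (x ∷ y ∷ []) [] ((x , y) ∷ []))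
  seeded-start = record
    { queued = λ () ; base-xy = λ () ; distinct = []
    ; grown = λ { (here e) → inj₁ e ; (there (here e)) → inj₂ (inj₁ e) }
    ; x∈T = here refl ; y∈T = there (here refl) ; xy∈E = here refl
    ; sound = record { tree = root x y (loopless xy) ; near = near ; inG = inG }
    ; complete = λ () ; count = refl }
    where
    near : ∀ {u v} → (u , v) ∈ₑ ((x , y) ∷ []) → DistLe (Edge G) x y u v 2
    near (inj₁ (here refl)) = record { rootIn = xy ; path = stop ; short = z≤n ; contains = inj₁ (inj₁ (refl , refl)) }
    near (inj₂ (here refl)) = record { rootIn = xy ; path = stop ; short = z≤n ; contains = inj₁ (inj₂ (refl , refl)) }
    inG : ∀ {u v} → (u , v) ∈ₑ ((x , y) ∷ []) → Edge G u v
    inG (inj₁ (here refl)) = xy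
    inG (inj₂ (here refl)) = trans (Graph.sym G y x) xy

  seed-skip : ∀ {done s} c → Seeded done s → common x y c ≡ false → Seeded (done ++ c ∷ []) s
  seed-skip {done} c S not-common = record
    { queued = queued ; base-xy = base-xy ; distinct = distinct
    ; grown = λ p → Data.Sum.map₂ (Data.Sum.map₂ ∈-++⁺ˡ) (grown p)
    ; x∈T = x∈T ; y∈T = y∈T ; xy∈E = xy∈E ; sound = sound ; complete = complete′ ; count = count }
    where
    open Seeded S
    complete′ : ∀ {z} → z ∈ done ++ c ∷ [] → common x y z ≡ true → (z , x , y) ∈ _
    complete′ p is-common with ∈-++⁻ done p
    ... | inj₁ p′ = complete p′ is-common
    ... | inj₂ (here refl) with trans (≡-sym not-common) is-common
    ... | ()

  seed-add : ∀ {done T Q E} c → c ∉ done → Seeded done (st T Q E) → common x y c ≡ true →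
             Seeded (done ++ c ∷ []) (st (c ∷ T) (Q ++ (c , x , y) ∷ []) ((x , c) ∷ (y , c) ∷ E))
  seed-add {done} {T} {Q} {E} c c∉done S is-common = record
    { queued = queued′
    ; base-xy = base-xy′
    ; distinct = AllPairs.++⁺ distinct ([] ∷ [])
                   (All.tabulate (λ {e} o → (λ e≡ → c∉T (subst (_∈ T) e≡ (Queued.q∈T (queued o)))) ∷ []))
    ; grown = grown′
    ; x∈T = there x∈T ; y∈T = there y∈T ; xy∈E = there (there xy∈E)
    ; sound = sound⁺
    ; complete = complete′
    ; count = length-snoc Q (c , x , y) {q = 0} count′ }
    where
    open Seeded S renaming (count to count′)
    xc : Edge G x c
    xc = ∧-conicalˡ _ _ is-common
    yc : Edge G y c
    yc = ∧-conicalʳ _ _ is-common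
    c∉T : c ∉ T
    c∉T p with grown p
    ... | inj₁ c≡x = loopless xc (≡-sym c≡x)
    ... | inj₂ (inj₁ c≡y) = loopless yc (≡-sym c≡y)
    ... | inj₂ (inj₂ c∈done) = c∉done c∈done
    xy⊆T : ∀ {z} → z ∈ x ∷ y ∷ [] → z ∈ T
    xy⊆T (here refl) = x∈T
    xy⊆T (there (here refl)) = y∈T
    open AddTriangle sound (inj₁ xy∈E) start xy⊆T (s≤s z≤n) c c∉T xc yc
    queued′ : ∀ {z a b} → (z , a , b) ∈ Q ++ (c , x , y) ∷ [] → Queued 0 (c ∷ T) E⁺ z a b
    queued′ p with ∈-++⁻ Q p
    ... | inj₂ (here refl) = queued⁺
    ... | inj₁ o with base-xy o
    ... | _ , refl = keep (queued o) (λ e → loopless (Queued.aq∈G (queued o)) (≡-sym e))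
                                     (λ e → loopless (Queued.bq∈G (queued o)) (≡-sym e))
    base-xy′ : ∀ {e} → e ∈ Q ++ (c , x , y) ∷ [] → ∃ λ z → e ≡ (z , x , y)
    base-xy′ p with ∈-++⁻ Q p
    ... | inj₁ o = base-xy o
    ... | inj₂ (here refl) = c , refl
    grown′ : ∀ {z} → z ∈ c ∷ T → z ≡ x ⊎ z ≡ y ⊎ z ∈ done ++ c ∷ []
    grown′ (here refl) = inj₂ (inj₂ (∈-++⁺ʳ done (here refl)))
    grown′ (there p) = Data.Sum.map₂ (Data.Sum.map₂ ∈-++⁺ˡ) (grown p)
    complete′ : ∀ {z} → z ∈ done ++ c ∷ [] → common x y z ≡ true → (z , x , y) ∈ Q ++ (c , x , y) ∷ []
    complete′ p is-common′ with ∈-++⁻ done p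
    ... | inj₁ p′ = ∈-++⁺ˡ (complete p′ is-common′)
    ... | inj₂ (here refl) = ∈-++⁺ʳ Q (here refl)

  seed-step : ∀ done c s → c ∉ done → Seeded done s → Seeded (done ++ c ∷ []) (seed s c)
  seed-step done c (st T Q E) c∉done S with adj G x c ∧ adj G y c in is-common
  ... | true = seed-add c c∉done S is-common
  ... | false = seed-skip c S is-common

  s₀ : State n
  s₀ = initial G π x y

  seeded : Seeded (ordered π) s₀
  seeded = foldl-invariant seed Seeded seed-step (ordered π) [] _ (ordered-unique π) seeded-start

  initial-invariant : Invariant 0 (State.queue s₀) [] s₀
  initial-invariant = record
    { queue≡ = ≡-sym (++-identityʳ _) ; levelA = queued ; levelB = λ ()
    ; distinct = distinct ; bases-unqueued = bases-unqueued ; sound = sound }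
    where
    open Seeded seeded
    -- the bases are x and y, which are not neighbours of themselves
    bases-unqueued : ∀ {q a b e} → (q , a , b) ∈ State.queue s₀ → e ∈ State.queue s₀ →
                     proj₁ e ≢ a × proj₁ e ≢ b
    bases-unqueued p p′ with base-xy p | base-xy p′
    ... | _ , refl | _ , refl = (λ e → loopless (Queued.aq∈G (queued p′)) (≡-sym e))
                              , (λ e → loopless (Queued.bq∈G (queued p′)) (≡-sym e))

module Main {n : ℕ} (G : Graph n) (π : Permutation′ n) (x y : Fin n) (xy : Edge G x y) (γ : ℕ)
            (S-tree : IsTriangleTree (Sγ G x y γ)) where
  open Invariants G x y xy
  open Rounds G π
  open Fairness G π x y xy
  open Start G π x y xy

  Svs : List (Fin n)
  Svs = proj₁ S-tree
  Ses : List (Fin n × Fin n)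
  Ses = proj₁ (proj₂ S-tree)
  S-TT : TT Svs Ses
  S-TT = proj₁ (proj₂ (proj₂ S-tree))

  in-S : ∀ {u v} → DistLe (Edge G) x y u v γ → (u , v) ∈ₑ Ses
  in-S {u} {v} dl = Equivalence.to (proj₂ (proj₂ (proj₂ S-tree)) u v) ((γ , dl) , dl)

  tree⊆S : ∀ {h A B s} → Invariant h A B s → suc (suc h) ≤ γ →
           ∀ {u v} → (u , v) ∈ₑ State.edges s → (u , v) ∈ₑ Ses
  tree⊆S inv h+2≤γ p = in-S (distLe-weaken (Sound.near (Invariant.sound inv) p) h+2≤γ)

  S*es : List (Fin n × Fin n)
  S*es = S*edges G π x y

  rounds-done : State.queue (rounds n s₀) ≡ []
  rounds-done = terminates n s₀ (0 , _ , [] , initial-invariant)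
    (+-monoˡ-≤ n (subst (length (State.queue s₀) ≤_) (Seeded.count seeded) (m≤m+n _ 2)))

  S*≡ : S*es ≡ State.edges (rounds n s₀)
  S*≡ = cong State.edges (run≡rounds n s₀)

  reached⊆S* : ∀ {s} → Reaches s₀ s → ∀ {u v} → (u , v) ∈ₑ State.edges s → (u , v) ∈ₑ S*es
  reached⊆S* {s} (k , refl) =
    ∈ₑ-mono (λ p → subst (_ ∈_) (≡-sym S*≡) (subst (λ s′ → _ ∈ State.edges s′) stable (edges-reaches (n , refl) p)))
    where
    stable : rounds n (rounds k s₀) ≡ rounds n s₀
    stable = begin
      rounds n (rounds k s₀)  ≡⟨ ≡-sym (rounds-+ k n s₀) ⟩
      rounds (k + n) s₀       ≡⟨ cong (λ m → rounds m s₀) (+-comm k n) ⟩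
      rounds (n + k) s₀       ≡⟨ rounds-+ n k s₀ ⟩
      rounds k (rounds n s₀)  ≡⟨ rounds-idle k rounds-done ⟩
      rounds n s₀             ∎
      where open ≡-Reasoning

  S*⊆G : ∀ {u v} → (u , v) ∈ₑ S*es → Edge G u v
  S*⊆G p with good-rounds n s₀ (0 , _ , [] , initial-invariant)
  ... | h , A , B , inv = Sound.inG (Invariant.sound inv) (subst (λ es → _ ∈ₑ es) S*≡ p)

  record Serving {vis c d} (rp : Prefix (Edge G) x y vis c d) : Set where
    field
      s : State n
      reached : Reaches s₀ s
      h : ℕ
      A B : List (Item n)
      a b : Fin n
      invariant : Invariant h ((d , a , b) ∷ A) B s
      c∈ab : c ≡ a ⊎ c ≡ b
      a∈vis : a ∈ vis
      b∈vis : b ∈ vis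
      level< : suc h ≤ plen rp

  module NextTriangle {vis c d} (rp : Prefix (Edge G) x y vis c d) (σ : Serving rp)
                      (w : Fin n) (w∉vis : w ∉ vis) (cw : Edge G c w) (dw : Edge G d w)
                      (short : suc (plen rp) ≤ γ) where
    open Serving σ
    T : List (Fin n)
    T = State.inTree s
    module HD = Queued (Invariant.levelA invariant (here refl))

    h+2≤γ : suc (suc h) ≤ γ
    h+2≤γ = ≤-trans (s≤s level<) short

    new-in-S : ∀ {u v} → (u , v) ≡ (c , w) ⊎ (u , v) ≡ (d , w) → (u , v) ∈ₑ Ses
    new-in-S which = in-S (distLe-last rp w w∉vis cw dw xy short which)

    w≢ : ∀ {z} → z ∈ vis → w ≢ z
    w≢ z∈ refl = w∉vis z∈

    -- w is not yet in the tree: otherwise dw would be an edge of S_γ between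
    -- tree vertices, hence (S_γ being a triangle-tree) a tree edge at d,
    -- whose only tree-neighbours are a, b ∈ vis.
    w∉T : w ∉ T
    w∉T w∈T with HD.only w (flipₑ (induced (Sound.tree (Invariant.sound invariant)) S-TT
                                           (tree⊆S invariant h+2≤γ) HD.q∈T w∈T (new-in-S (inj₂ refl))))
    ... | inj₁ w≡a = w≢ a∈vis w≡a
    ... | inj₂ w≡b = w≢ b∈vis w≡b

    -- If c = b while w is also a common neighbour of a and d, then a, b, d, w
    -- would span a K₄ in S_γ.
    no-other-base : c ≡ b → common a d w ≡ true → ⊥
    no-other-base refl ad = no-K4 S-TT a≢b d≢a d≢b (w≢ a∈vis) (w≢ b∈vis) (w≢ (proj₂ (prefix-ends rp)))
                              (old HD.ab∈E) (old HD.aq∈E) (old HD.bq∈E)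
                              aw∈S (new-in-S (inj₂ refl)) (new-in-S (inj₁ refl))
      where
      old : ∀ {u v} → (u , v) ∈ₑ State.edges s → (u , v) ∈ₑ Ses
      old = tree⊆S invariant h+2≤γ
      a≢b : a ≢ b
      a≢b = tt-looplessₑ (Sound.tree (Invariant.sound invariant)) HD.ab∈E
      d≢a : d ≢ a
      d≢a refl = HD.q∉vis (proj₁ (prefix-ends HD.prefix))
      d≢b : d ≢ b
      d≢b refl = HD.q∉vis (proj₂ (prefix-ends HD.prefix))
      -- aw is within distance h + 1: the head's prefix followed by abw
      aw∈S : (a , w) ∈ₑ Ses
      aw∈S = in-S (distLe-last HD.prefix w (λ p → w∉T (HD.vis⊆T p)) (∧-conicalˡ _ _ ad) cw xy
                    (≤-trans (≤-reflexive (cong suc HD.prefix-len)) (≤-trans (n≤1+n _) h+2≤γ)) (inj₁ refl))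

    common-cd : common c d w ≡ true
    common-cd = cong₂ _∧_ cw dw

    is-common : common a d w ≡ true ⊎ common b d w ≡ true
    is-common with c∈ab
    ... | inj₁ refl = inj₁ common-cd
    ... | inj₂ refl = inj₂ common-cd

    chosen-is-c : ∀ {c′} → Chosen a b d w c′ → c′ ≡ c
    chosen-is-c (inj₁ (refl , ad)) with c∈ab
    ... | inj₁ refl = refl
    ... | inj₂ c≡b = ⊥-elim (no-other-base c≡b ad)
    chosen-is-c (inj₂ (refl , ad , _)) with c∈ab
    ... | inj₂ refl = refl
    ... | inj₁ refl with trans (≡-sym ad) common-cd
    ... | ()

    result : RoundResult π h A B s d a b
    result = round-result π s invariant
    module R = RoundResult result

    queued : (w , c , d) ∈ B ++ R.new
    queued with R.complete w∉T is-common
    ... | c′ , i , ch = ∈-++⁺ʳ B (subst (λ z → (w , z , d) ∈ R.new) (chosen-is-c ch) i)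

  next-base : ∀ {c d : Fin n} nx → (if nx then c else d) ≡ c ⊎ (if nx then c else d) ≡ d
  next-base true = inj₁ refl
  next-base false = inj₂ refl

  path⊆S* : ∀ {vis c d} (rp : Prefix (Edge G) x y vis c d) (tp : TPath (Edge G) vis c d) →
            plen rp + len tp ≤ γ → Serving rp → ∀ {u v} → Added tp u v → (u , v) ∈ₑ S*es
  path⊆S* {c = c} {d} rp (step w w∉vis cw dw nx tp) bound σ = added
    where
    open Serving σ
    short : suc (plen rp) ≤ γ
    short = ≤-trans (s≤s (m≤m+n _ _)) (≤-trans (≤-reflexive (≡-sym (+-suc (plen rp) (len tp)))) bound)
    open NextTriangle rp σ w w∉vis cw dw short
    reached′ : Reaches s₀ (round s)
    reached′ = reaches-trans reached (reaches-round s)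
    item : Queued (suc h) (State.inTree (round s)) (State.edges (round s)) w c d
    item = Invariant.levelB R.invariant queued
    added : ∀ {u v} → Added (step w w∉vis cw dw nx tp) u v → (u , v) ∈ₑ S*es
    added new-c = reached⊆S* reached′ (Queued.aq∈E item)
    added new-d = reached⊆S* reached′ (Queued.bq∈E item)
    added (later ad) with serve-next (round s) R.invariant queued
    ... | s″ , r , A″ , B″ , inv″ =
      path⊆S* (extend rp w w∉vis cw dw nx) tp (subst (_≤ γ) (+-suc (plen rp) (len tp)) bound)
        (record { s = s″ ; reached = reaches-trans reached′ r ; h = suc h ; A = A″ ; B = B″ ; a = c ; b = d
                ; invariant = inv″ ; c∈ab = next-base nx
                ; a∈vis = there (proj₁ (prefix-ends rp)) ; b∈vis = there (proj₂ (prefix-ends rp))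
                ; level< = s≤s level< }) ad

  -- The first triangle xyw is queued initially, so its continuation is served.
  root-path⊆S* : (tp : TPath (Edge G) (x ∷ y ∷ []) x y) → len tp ≤ γ →
                 ∀ {u v} → Added tp u v → (u , v) ∈ₑ S*es
  root-path⊆S* (step w w∉xy xw yw nx tp) bound = added
    where
    queued : (w , x , y) ∈ State.queue s₀
    queued = Seeded.complete seeded (∈-ordered π w) (cong₂ _∧_ xw yw)
    item : Queued 0 (State.inTree s₀) (State.edges s₀) w x y
    item = Seeded.queued seeded queued
    added : ∀ {u v} → Added (step w w∉xy xw yw nx tp) u v → (u , v) ∈ₑ S*es
    added new-c = reached⊆S* (reaches-refl s₀) (Queued.aq∈E item)
    added new-d = reached⊆S* (reaches-refl s₀) (Queued.bq∈E item)
    added (later ad) with serve-current s₀ initial-invariant queued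
    ... | s , r , A , B , inv =
      path⊆S* (extend start w w∉xy xw yw nx) tp bound
        (record { s = s ; reached = r ; h = 0 ; A = A ; B = B ; a = x ; b = y ; invariant = inv
                ; c∈ab = next-base nx ; a∈vis = there (here refl) ; b∈vis = there (there (here refl))
                ; level< = s≤s z≤n }) ad

  root∈S* : (x , y) ∈ₑ S*es
  root∈S* = reached⊆S* (reaches-refl s₀) (inj₁ (Seeded.xy∈E seeded))

proposition3p1 : ∀ {n} (G : Graph n) (π : Permutation′ n) (x y : Fin n) →
                 Edge G x y → (γ : ℕ) →
                 IsTriangleTree (Sγ G x y γ) →
                 ∀ u v → S*γ G π x y γ u v ⇔ Sγ G x y γ u v
proposition3p1 G π x y xy γ S-tree u v = mk⇔ to from
  where
  open Main G π x y xy γ S-tree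
  to : S*γ G π x y γ u v → Sγ G x y γ u v
  to (_ , dl) = (γ , dl-G) , dl-G
    where dl-G = distLe-transfer xy dl (λ ad → S*⊆G (added-edge (PathWithin.path dl) ad))
  from : Sγ G x y γ u v → S*γ G π x y γ u v
  from (_ , dl) = uv∈S* (PathWithin.contains dl) , distLe-transfer root∈S* dl P⊆S*
    where
    P : TPath (Edge G) (x ∷ y ∷ []) x y
    P = PathWithin.path dl
    P⊆S* : ∀ {p q} → Added P p q → (p , q) ∈ₑ S*es
    P⊆S* = root-path⊆S* P (PathWithin.short dl)
    uv∈S* : ((u ≡ x × v ≡ y) ⊎ (u ≡ y × v ≡ x)) ⊎ (Added P u v ⊎ Added P v u) → S* G π x y u v
    uv∈S* (inj₁ (inj₁ (refl , refl))) = root∈S*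
    uv∈S* (inj₁ (inj₂ (refl , refl))) = flipₑ root∈S*
    uv∈S* (inj₂ (inj₁ ad)) = P⊆S* ad
    uv∈S* (inj₂ (inj₂ ad)) = flipₑ (P⊆S* ad)
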